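{- In $\mathbb{Q}[[x]]$ we have the continued fraction expansion $$\sum_{n\geq 0} E_n x^n = b_0+\cfrac{a_1}{b_1+\cfrac{a_2}{b_2+\cfrac{a_3}{b_3+\cdots}}},$$ where $a_1=1$; $a_{3k}=-(4k-1)^2(2k-1)x^3$ for $k\ge1$; $a_{3k+1}=-4k^2x^2$ for $k\ge 1$; $a_{3k+2}=-(4k+1)^2(2k+1)x^3$ for $k\ge 0$; and $b_0=0$; $b_{3k}=1-(6k-1)x$ for $k\ge1$; $b_{3k+1}=1-(6k+1)x$ for $k\ge0$; $b_{3k+2}=1-2(2k+1)x-4(2k+1)^2x^2$ for $k\ge0$. Explicitly, the expansion begins $$\frac{1}{1-x-\cfrac{x^3}{1-2x-4x^2-\cfrac{9x^3}{1-5x-\cfrac{4x^2}{1-7x-\cfrac{75x^3}{1-6x-36x^2-\cdots}}}}}.$$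
   Context: The Euler numbers $E_n$ ($n\ge 0$) are defined by $\tan(x)+\sec(x)=\sum_{n\ge0}E_n\frac{x^n}{n!}$ (so $E_0,E_1,E_2,\dots=1,1,1,2,5,16,61,272,\dots$). A continued fraction $b_0+\cfrac{a_1}{b_1+\cfrac{a_2}{b_2+\cdots}}$ with $a_j,b_j$ polynomials in $x$ denotes the formal power series in $x$ which is the $x$-adic limit of its successive convergents. -}

module Defs where

open import Data.Nat as ℕ using (ℕ; zero; suc; _≡ᵇ_; _!; _∸_)
open import Data.Nat.DivMod using (_/_; _%_)
open import Data.Integer as ℤ using (+_)
open import Data.Rational as ℚ using (ℚ; 0ℚ; 1ℚ; _+_; _*_; _-_; -_; 1/_; ≢-nonZero)
open import Data.Rational.Properties using (_≟_)
open import Data.List using (List; []; _∷_; map; upTo; zipWith; foldr)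
open import Data.Bool using (if_then_else_)
open import Relation.Nullary using (yes; no)

-- Formal power series over ℚ, represented by their coefficient sequences.
Series : Set
Series = ℕ → ℚ

ℕtoℚ : ℕ → ℚ
ℕtoℚ n = ℚ._/_ (+ n) 1

-- total inverse on ℚ (0⁻¹ := 0 by convention; only ever used at nonzero values here)
invQ : ℚ → ℚ
invQ q with q ≟ 0ℚ
... | yes _ = 0ℚ
... | no q≢0 = 1/_ q {{≢-nonZero q≢0}}

sumQ : List ℚ → ℚ
sumQ = foldr _+_ 0ℚ

mono : ℚ → ℕ → Series
mono c d n = if n ≡ᵇ d then c else 0ℚ

_⊕_ : Series → Series → Series
(f ⊕ g) n = f n + g n
infixl 6 _⊕_

-- Quotient h / f in ℚ[[x]] (meaningful when f 0 ≠ 0):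
-- g₀ = h₀ / f₀,  g_n = (h_n - Σ_{k=1}^{n} f_k g_{n-k}) / f₀.
-- divRev h f n = [g_n, g_{n-1}, …, g_0].
divRev : Series → Series → ℕ → List ℚ
divRev h f zero = h 0 * invQ (f 0) ∷ []
divRev h f (suc n) =
  let prev = divRev h f n
      s    = sumQ (zipWith _*_ (map (λ i → f (suc i)) (upTo (suc n))) prev)
  in (h (suc n) - s) * invQ (f 0) ∷ prev

headQ : List ℚ → ℚ
headQ [] = 0ℚ
headQ (q ∷ _) = q

_⊘_ : Series → Series → Series
(h ⊘ f) n = headQ (divRev h f n)
infixl 7 _⊘_

sinS : Series
sinS n with n % 2
... | 1 = (if (n / 2) % 2 ≡ᵇ 0 then 1ℚ else - 1ℚ) * invQ (ℕtoℚ (n !))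
... | _ = 0ℚ

cosS : Series
cosS n with n % 2
... | 0 = (if (n / 2) % 2 ≡ᵇ 0 then 1ℚ else - 1ℚ) * invQ (ℕtoℚ (n !))
... | _ = 0ℚ

-- tan x + sec x = (sin x + 1) / cos x
tanPlusSec : Series
tanPlusSec = (sinS ⊕ mono 1ℚ 0) ⊘ cosS

-- Euler numbers: tan x + sec x = Σ E_n x^n / n!
E : ℕ → ℚ
E n = ℕtoℚ (n !) * tanPlusSec n

-- partial numerators a_j (a_0 is unused; set to 0)
a' : ℕ → ℕ → Series            -- a' k r = a_{3k+r}
a' zero 0 = mono 0ℚ 0
a' zero 1 = mono 1ℚ 0
a' k 2 = mono (- ℕtoℚ ((4 ℕ.* k ℕ.+ 1) ℕ.^ 2 ℕ.* (2 ℕ.* k ℕ.+ 1))) 3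
a' (suc j) 0 = let k = suc j in
  mono (- ℕtoℚ ((4 ℕ.* k ∸ 1) ℕ.^ 2 ℕ.* (2 ℕ.* k ∸ 1))) 3
a' (suc j) 1 = let k = suc j in mono (- ℕtoℚ (4 ℕ.* k ℕ.^ 2)) 2
a' _ _ = mono 0ℚ 0

a : ℕ → Series
a j = a' (j / 3) (j % 3)

b' : ℕ → ℕ → Series            -- b' k r = b_{3k+r}
b' zero 0 = mono 0ℚ 0
b' (suc j) 0 = let k = suc j in mono 1ℚ 0 ⊕ mono (- ℕtoℚ (6 ℕ.* k ∸ 1)) 1
b' k 1 = mono 1ℚ 0 ⊕ mono (- ℕtoℚ (6 ℕ.* k ℕ.+ 1)) 1
b' k 2 = mono 1ℚ 0 ⊕ mono (- ℕtoℚ (2 ℕ.* (2 ℕ.* k ℕ.+ 1))) 1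
               ⊕ mono (- ℕtoℚ (4 ℕ.* (2 ℕ.* k ℕ.+ 1) ℕ.^ 2)) 2
b' _ _ = mono 0ℚ 0

b : ℕ → Series
b j = b' (j / 3) (j % 3)

-- tailCF j r = b_j + a_{j+1} / (b_{j+1} + … + a_{j+r} / b_{j+r})
tailCF : ℕ → ℕ → Series
tailCF j zero = b j
tailCF j (suc r) = b j ⊕ (a (suc j) ⊘ tailCF (suc j) r)

convergent : ℕ → Series
convergent m = tailCF 0 m

module Submission where

-- 1. ℚ[[x]] is a commutative ring; series with invertible constant term
--    can be divided (the division ⊘ of Defs is the unique quotient), and
--    all operations are local: coefficients up to x^k only depend on
--    coefficients up to x^k.  A ring solver over ℚ[[x]] is set up.
-- 2. With the formal derivative D, D sin = cos and D cos = - sin give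
--    sin² + cos² = 1, and F = tan + sec = (1 + sin)/cos satisfies the
--    Riccati equation  D F = (1 + F²)/2.
-- 3. Hence the numbers V k n = n! [x^n] (F - 1)^k obey a three-term
--    recurrence, which is also the recurrence of weighted Motzkin paths
--    generated by the J-fraction  G_k = 1/(1 - k x - k(k+1)/2 x² G_{k+1}).
--    Comparing the two gives  Σ E_n x^n = 1 + x G_1.
-- 4. Contracting the J-fraction: the tails T_j of the continued fraction of
--    the theorem are explicit quotients of the G_k (period 3 in j against
--    period 4 in k); each step T_j = b_j + a_{j+1}/T_{j+1} is a polynomial
--    identity modulo the J-fraction relations.  By locality the convergents
--    then agree with 1/T_1 = Σ E_n x^n up to their depth.

open import Defs
open import Data.Nat as ℕ using (ℕ; zero; suc; _≤_; _<_; z≤n; s≤s; _∸_)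
import Data.Nat.Properties as ℕP
open import Data.Nat.DivMod as ℕDM using (_/_; _%_)
open import Data.Nat.Divisibility using (n∣m*n)
open import Data.Nat.Tactic.RingSolver using (solve-∀)
import Data.Integer as ℤ
import Data.Integer.Properties as ℤP
import Data.Nat.Coprimality as Coprimality
open import Data.Rational as ℚ using (ℚ; 0ℚ; 1ℚ; ½; _+_; _*_; _-_; -_; mkℚ)
open import Data.Rational.Properties
import Data.Rational.Solver as ℚSolver
open import Data.Bool using (true; false; if_then_else_)
open import Data.List using (List; []; _∷_; map; zipWith; upTo; applyUpTo)
open import Data.Product using (Σ; ∃-syntax; _,_)
open import Data.Sum using (_⊎_; inj₁; inj₂)
open import Data.Empty using (⊥-elim)
open import Relation.Nullary using (yes; no)
open import Relation.Binary.PropositionalEquality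
  using (_≡_; _≢_; refl; sym; trans; cong; cong₂; subst; module ≡-Reasoning)
open import Relation.Binary.Structures using (IsEquivalence)
open import Algebra.Bundles using (CommutativeRing)
open import Level using (0ℓ)
import Algebra.Solver.Ring.AlmostCommutativeRing as ACR
import Algebra.Solver.Ring
import Data.Maybe as Maybe
import Relation.Binary.Reasoning.Setoid as SetoidReasoning
import Algebra.Properties.Group as GroupProperties

module ℚ-Solver = ℚSolver.+-*-Solver

ℕtoℚ-canonical : ∀ n → ℕtoℚ n ≡ mkℚ (ℤ.+ n) 0 (Coprimality.sym (Coprimality.1-coprimeTo n))
ℕtoℚ-canonical n = normalize-coprime (Coprimality.sym (Coprimality.1-coprimeTo n))

ℕtoℚ-suc : ∀ n → ℕtoℚ (suc n) ≡ 1ℚ + ℕtoℚ n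
ℕtoℚ-suc n rewrite ℕtoℚ-canonical n | ℕP.*-identityʳ n | ℤP.+◃n≡+n n = refl

ℕtoℚ-+ : ∀ m n → ℕtoℚ (m ℕ.+ n) ≡ ℕtoℚ m + ℕtoℚ n
ℕtoℚ-+ zero n = sym (+-identityˡ (ℕtoℚ n))
ℕtoℚ-+ (suc m) n = begin
  ℕtoℚ (suc (m ℕ.+ n))      ≡⟨ ℕtoℚ-suc (m ℕ.+ n) ⟩
  1ℚ + ℕtoℚ (m ℕ.+ n)       ≡⟨ cong (1ℚ +_) (ℕtoℚ-+ m n) ⟩
  1ℚ + (ℕtoℚ m + ℕtoℚ n)    ≡⟨ sym (+-assoc 1ℚ (ℕtoℚ m) (ℕtoℚ n)) ⟩
  (1ℚ + ℕtoℚ m) + ℕtoℚ n    ≡⟨ cong (_+ ℕtoℚ n) (sym (ℕtoℚ-suc m)) ⟩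
  ℕtoℚ (suc m) + ℕtoℚ n     ∎
  where open ≡-Reasoning

ℕtoℚ-* : ∀ m n → ℕtoℚ (m ℕ.* n) ≡ ℕtoℚ m * ℕtoℚ n
ℕtoℚ-* zero n = sym (*-zeroˡ (ℕtoℚ n))
ℕtoℚ-* (suc m) n = begin
  ℕtoℚ (n ℕ.+ m ℕ.* n)        ≡⟨ ℕtoℚ-+ n (m ℕ.* n) ⟩
  ℕtoℚ n + ℕtoℚ (m ℕ.* n)     ≡⟨ cong (ℕtoℚ n +_) (ℕtoℚ-* m n) ⟩
  ℕtoℚ n + ℕtoℚ m * ℕtoℚ n    ≡⟨ solve 2 (λ a b → b :+ a :* b := (con 1ℚ :+ a) :* b) refl (ℕtoℚ m) (ℕtoℚ n) ⟩
  (1ℚ + ℕtoℚ m) * ℕtoℚ n      ≡⟨ cong (_* ℕtoℚ n) (sym (ℕtoℚ-suc m)) ⟩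
  ℕtoℚ (suc m) * ℕtoℚ n       ∎
  where open ≡-Reasoning; open ℚ-Solver

ℕtoℚ-injective : ∀ m n → ℕtoℚ m ≡ ℕtoℚ n → m ≡ n
ℕtoℚ-injective m n eq
  with cong ℚ.numerator (trans (sym (ℕtoℚ-canonical m)) (trans eq (ℕtoℚ-canonical n)))
... | refl = refl

ℕtoℚ-suc≢0 : ∀ n → ℕtoℚ (suc n) ≢ 0ℚ
ℕtoℚ-suc≢0 n eq with ℕtoℚ-injective (suc n) 0 eq
... | ()

≡1⇒≢0 : ∀ {q} → q ≡ 1ℚ → q ≢ 0ℚ
≡1⇒≢0 refl ()

invQ-inverseʳ : ∀ q → q ≢ 0ℚ → q * invQ q ≡ 1ℚ
invQ-inverseʳ q q≢0 with q ≟ 0ℚ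
... | yes q≡0 = ⊥-elim (q≢0 q≡0)
... | no q≢0' = *-inverseʳ q {{ℚ.≢-nonZero q≢0'}}

invQ-cancelˡ : ∀ q p → q ≢ 0ℚ → invQ q * (q * p) ≡ p
invQ-cancelˡ q p q≢0 = begin
  invQ q * (q * p)   ≡⟨ sym (*-assoc (invQ q) q p) ⟩
  (invQ q * q) * p   ≡⟨ cong (_* p) (trans (*-comm (invQ q) q) (invQ-inverseʳ q q≢0)) ⟩
  1ℚ * p             ≡⟨ *-identityˡ p ⟩
  p                  ∎
  where open ≡-Reasoning

*-cancelˡ-≢0 : ∀ c p q → c ≢ 0ℚ → c * p ≡ c * q → p ≡ q
*-cancelˡ-≢0 c p q c≢0 eq =
  trans (sym (invQ-cancelˡ c p c≢0)) (trans (cong (invQ c *_) eq) (invQ-cancelˡ c q c≢0))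

invQ-unique : ∀ q r → q * r ≡ 1ℚ → invQ q ≡ r
invQ-unique q r qr≡1 = *-cancelˡ-≢0 q (invQ q) r q≢0 (trans (invQ-inverseʳ q q≢0) (sym qr≡1))
  where
  q≢0 : q ≢ 0ℚ
  q≢0 q≡0 = 1≢0 (trans (sym qr≡1) (trans (cong (_* r) q≡0) (*-zeroˡ r)))

infix 4 _≈_
_≈_ : Series → Series → Set
f ≈ g = ∀ n → f n ≡ g n

≈-refl : ∀ {f} → f ≈ f
≈-refl _ = refl

≈-sym : ∀ {f g} → f ≈ g → g ≈ f
≈-sym p n = sym (p n)

≈-trans : ∀ {f g h} → f ≈ g → g ≈ h → f ≈ h
≈-trans p q n = trans (p n) (q n)

≡⇒≈ : ∀ {f g : Series} → f ≡ g → f ≈ g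
≡⇒≈ refl = ≈-refl

0S 1S : Series
0S _ = 0ℚ
1S = mono 1ℚ 0

negS : Series → Series
negS f n = - f n

tl : Series → Series
tl f n = f (suc n)

sc : ℚ → Series → Series
sc c f n = c * f n

infixl 7 _⊛_
_⊛_ : Series → Series → Series
(f ⊛ g) zero = f 0 * g 0
(f ⊛ g) (suc n) = f 0 * g (suc n) + (tl f ⊛ g) n

⊕-cong : ∀ {f f' g g'} → f ≈ f' → g ≈ g' → f ⊕ g ≈ f' ⊕ g'
⊕-cong p q n = cong₂ _+_ (p n) (q n)

⊕-congʳ : ∀ f {g g'} → g ≈ g' → f ⊕ g ≈ f ⊕ g'
⊕-congʳ f = ⊕-cong {f = f} ≈-refl

negS-cong : ∀ {f g} → f ≈ g → negS f ≈ negS g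
negS-cong p n = cong -_ (p n)

⊛-cong : ∀ {f f' g g'} → f ≈ f' → g ≈ g' → f ⊛ g ≈ f' ⊛ g'
⊛-cong ff gg zero = cong₂ _*_ (ff 0) (gg 0)
⊛-cong ff gg (suc n) = cong₂ _+_ (cong₂ _*_ (ff 0) (gg (suc n))) (⊛-cong (λ k → ff (suc k)) gg n)

⊛-congʳ : ∀ f {g g'} → g ≈ g' → f ⊛ g ≈ f ⊛ g'
⊛-congʳ f = ⊛-cong {f = f} ≈-refl

⊛-congˡ : ∀ {f f'} g → f ≈ f' → f ⊛ g ≈ f' ⊛ g
⊛-congˡ g p = ⊛-cong {g = g} p ≈-refl

⊛-zeroˡ : ∀ g → 0S ⊛ g ≈ 0S
⊛-zeroˡ g zero = *-zeroˡ (g 0)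
⊛-zeroˡ g (suc n) = trans (cong₂ _+_ (*-zeroˡ (g (suc n))) (⊛-zeroˡ g n)) (+-identityˡ 0ℚ)

⊛-identityˡ : ∀ g → 1S ⊛ g ≈ g
⊛-identityˡ g zero = *-identityˡ (g 0)
⊛-identityˡ g (suc n) = begin
  1ℚ * g (suc n) + (tl 1S ⊛ g) n   ≡⟨ cong₂ _+_ (*-identityˡ (g (suc n))) (⊛-zeroˡ g n) ⟩
  g (suc n) + 0ℚ                   ≡⟨ +-identityʳ _ ⟩
  g (suc n)                        ∎
  where open ≡-Reasoning

⊛-distribʳ : ∀ f f' g → (f ⊕ f') ⊛ g ≈ f ⊛ g ⊕ f' ⊛ g
⊛-distribʳ f f' g zero = *-distribʳ-+ (g 0) (f 0) (f' 0)
⊛-distribʳ f f' g (suc n) = begin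
  (f 0 + f' 0) * g (suc n) + ((tl f ⊕ tl f') ⊛ g) n
    ≡⟨ cong₂ _+_ (*-distribʳ-+ (g (suc n)) (f 0) (f' 0)) (⊛-distribʳ (tl f) (tl f') g n) ⟩
  (f 0 * g (suc n) + f' 0 * g (suc n)) + ((tl f ⊛ g) n + (tl f' ⊛ g) n)
    ≡⟨ solve 4 (λ a b c d → (a :+ b) :+ (c :+ d) := (a :+ c) :+ (b :+ d)) refl
         (f 0 * g (suc n)) (f' 0 * g (suc n)) ((tl f ⊛ g) n) ((tl f' ⊛ g) n) ⟩
  (f 0 * g (suc n) + (tl f ⊛ g) n) + (f' 0 * g (suc n) + (tl f' ⊛ g) n) ∎
  where open ≡-Reasoning; open ℚ-Solver

⊛-sc : ∀ c f g → sc c f ⊛ g ≈ sc c (f ⊛ g)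
⊛-sc c f g zero = *-assoc c (f 0) (g 0)
⊛-sc c f g (suc n) = begin
  c * f 0 * g (suc n) + (sc c (tl f) ⊛ g) n
    ≡⟨ cong₂ _+_ (*-assoc c (f 0) (g (suc n))) (⊛-sc c (tl f) g n) ⟩
  c * (f 0 * g (suc n)) + c * (tl f ⊛ g) n  ≡⟨ sym (*-distribˡ-+ c _ _) ⟩
  c * (f 0 * g (suc n) + (tl f ⊛ g) n)      ∎
  where open ≡-Reasoning

⊛-suc : ∀ f g n → (f ⊛ g) (suc n) ≡ f (suc n) * g 0 + (f ⊛ tl g) n
⊛-suc f g zero = +-comm (f 0 * g 1) (f 1 * g 0)
⊛-suc f g (suc n) = begin
  f 0 * g (suc (suc n)) + (tl f ⊛ g) (suc n)
    ≡⟨ cong (f 0 * g (suc (suc n)) +_) (⊛-suc (tl f) g n) ⟩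
  f 0 * g (suc (suc n)) + (f (suc (suc n)) * g 0 + (tl f ⊛ tl g) n)
    ≡⟨ solve 3 (λ a b c → a :+ (b :+ c) := b :+ (a :+ c)) refl
         (f 0 * g (suc (suc n))) (f (suc (suc n)) * g 0) ((tl f ⊛ tl g) n) ⟩
  f (suc (suc n)) * g 0 + (f 0 * g (suc (suc n)) + (tl f ⊛ tl g) n) ∎
  where open ≡-Reasoning; open ℚ-Solver

⊛-comm : ∀ f g → f ⊛ g ≈ g ⊛ f
⊛-comm f g zero = *-comm (f 0) (g 0)
⊛-comm f g (suc n) = begin
  f 0 * g (suc n) + (tl f ⊛ g) n   ≡⟨ cong₂ _+_ (*-comm (f 0) (g (suc n))) (⊛-comm (tl f) g n) ⟩
  g (suc n) * f 0 + (g ⊛ tl f) n   ≡⟨ sym (⊛-suc g f n) ⟩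
  (g ⊛ f) (suc n)                  ∎
  where open ≡-Reasoning

⊛-assoc : ∀ f g h → (f ⊛ g) ⊛ h ≈ f ⊛ (g ⊛ h)
⊛-assoc f g h zero = *-assoc (f 0) (g 0) (h 0)
⊛-assoc f g h (suc n) = begin
  (f 0 * g 0) * h (suc n) + ((sc (f 0) (tl g) ⊕ (tl f ⊛ g)) ⊛ h) n
    ≡⟨ cong ((f 0 * g 0) * h (suc n) +_) (⊛-distribʳ (sc (f 0) (tl g)) (tl f ⊛ g) h n) ⟩
  (f 0 * g 0) * h (suc n) + ((sc (f 0) (tl g) ⊛ h) n + ((tl f ⊛ g) ⊛ h) n)
    ≡⟨ cong₂ (λ u v → (f 0 * g 0) * h (suc n) + (u + v)) (⊛-sc (f 0) (tl g) h n) (⊛-assoc (tl f) g h n) ⟩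
  (f 0 * g 0) * h (suc n) + (f 0 * (tl g ⊛ h) n + (tl f ⊛ (g ⊛ h)) n)
    ≡⟨ solve 5 (λ a b c d e → (a :* b) :* c :+ (a :* d :+ e) := a :* (b :* c :+ d) :+ e) refl
         (f 0) (g 0) (h (suc n)) ((tl g ⊛ h) n) ((tl f ⊛ (g ⊛ h)) n) ⟩
  f 0 * (g 0 * h (suc n) + (tl g ⊛ h) n) + (tl f ⊛ (g ⊛ h)) n ∎
  where open ≡-Reasoning; open ℚ-Solver

seriesRing : CommutativeRing 0ℓ 0ℓ
seriesRing = record
  { Carrier = Series ; _≈_ = _≈_ ; _+_ = _⊕_ ; _*_ = _⊛_ ; -_ = negS ; 0# = 0S ; 1# = 1S
  ; isCommutativeRing = record
    { isRing = record
      { +-isAbelianGroup = record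
        { isGroup = record
          { isMonoid = record
            { isSemigroup = record
              { isMagma = record { isEquivalence = ≈-isEquivalence ; ∙-cong = ⊕-cong }
              ; assoc = λ f g h n → +-assoc (f n) (g n) (h n) }
            ; identity = (λ f n → +-identityˡ (f n)) , (λ f n → +-identityʳ (f n)) }
          ; inverse = (λ f n → +-inverseˡ (f n)) , (λ f n → +-inverseʳ (f n))
          ; ⁻¹-cong = negS-cong }
        ; comm = λ f g n → +-comm (f n) (g n) }
      ; *-cong = ⊛-cong
      ; *-assoc = ⊛-assoc
      ; *-identity = ⊛-identityˡ , (λ g → ≈-trans (⊛-comm g 1S) (⊛-identityˡ g))
      ; distrib = (λ g f f' → ≈-trans (⊛-comm g (f ⊕ f'))
                     (≈-trans (⊛-distribʳ f f' g) (⊕-cong (⊛-comm f g) (⊛-comm f' g))))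
                , (λ g f f' → ⊛-distribʳ f f' g) }
    ; *-comm = ⊛-comm } }
  where
  ≈-isEquivalence : IsEquivalence _≈_
  ≈-isEquivalence = record { refl = ≈-refl ; sym = ≈-sym ; trans = ≈-trans }

module ≈-Reasoning = SetoidReasoning (CommutativeRing.setoid seriesRing)

-- Constant series; κ : ℚ → ℚ[[x]] is a ring homomorphism, which lets the
-- ring solver below use rational coefficients.

κ : ℚ → Series
κ c = mono c 0

κ-+ : ∀ p q → κ (p + q) ≈ κ p ⊕ κ q
κ-+ p q zero = refl
κ-+ p q (suc n) = sym (+-identityˡ 0ℚ)

κ-coeff : ∀ c f n → (κ c ⊛ f) n ≡ c * f n
κ-coeff c f zero = refl
κ-coeff c f (suc n) = trans (cong (c * f (suc n) +_) (⊛-zeroˡ f n)) (+-identityʳ _)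

κ-* : ∀ p q → κ (p * q) ≈ κ p ⊛ κ q
κ-* p q n = sym (trans (κ-coeff p (κ q) n) (lemma n))
  where
  lemma : ∀ n → p * κ q n ≡ κ (p * q) n
  lemma zero = refl
  lemma (suc n) = *-zeroʳ p

κ-neg : ∀ p → κ (- p) ≈ negS (κ p)
κ-neg p zero = refl
κ-neg p (suc n) = refl

κ-0 : κ 0ℚ ≈ 0S
κ-0 zero = refl
κ-0 (suc n) = refl

κ-cong : ∀ {p q} → p ≡ q → κ p ≈ κ q
κ-cong refl = ≈-refl

seriesAlmostRing : ACR.AlmostCommutativeRing 0ℓ 0ℓ
seriesAlmostRing = ACR.fromCommutativeRing seriesRing

κ-morphism : ACR._-Raw-AlmostCommutative⟶_ (CommutativeRing.rawRing +-*-commutativeRing) seriesAlmostRing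
κ-morphism = record
  { ⟦_⟧ = κ ; +-homo = κ-+ ; *-homo = κ-* ; -‿homo = κ-neg ; 0-homo = κ-0 ; 1-homo = λ _ → refl }

κ-equal? : ∀ p q → Maybe.Maybe (κ p ≈ κ q)
κ-equal? p q with p ≟ q
... | yes refl = Maybe.just ≈-refl
... | no _ = Maybe.nothing

module S-Solver = Algebra.Solver.Ring (CommutativeRing.rawRing +-*-commutativeRing) seriesAlmostRing κ-morphism κ-equal?

xS : Series
xS = mono 1ℚ 1

x-coeff0 : ∀ f → (xS ⊛ f) 0 ≡ 0ℚ
x-coeff0 f = *-zeroˡ (f 0)

x-coeffS : ∀ f n → (xS ⊛ f) (suc n) ≡ f n
x-coeffS f n = begin
  0ℚ * f (suc n) + (tl xS ⊛ f) n   ≡⟨ cong₂ _+_ (*-zeroˡ (f (suc n))) (⊛-congˡ f tl-x n) ⟩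
  0ℚ + (1S ⊛ f) n                  ≡⟨ trans (+-identityˡ _) (⊛-identityˡ f n) ⟩
  f n                              ∎
  where
  open ≡-Reasoning
  tl-x : tl xS ≈ 1S
  tl-x zero = refl
  tl-x (suc _) = refl

x-multiple0 : ∀ f g → (f ⊛ (xS ⊛ g)) 0 ≡ 0ℚ
x-multiple0 f g = trans (cong (f 0 *_) (x-coeff0 g)) (*-zeroʳ (f 0))

x-factor : ∀ {h} → h 0 ≡ 0ℚ → h ≈ xS ⊛ tl h
x-factor {h} h0 zero = trans h0 (sym (x-coeff0 (tl h)))
x-factor {h} h0 (suc n) = sym (x-coeffS (tl h) n)

-- The quotient h ⊘ f of Defs is computed by the recursion
-- (h/f)_{n+1} = (h_{n+1} - Σ_{k≤n} f_{k+1} (h/f)_{n-k}) / f₀,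
-- i.e. exactly by the recursion of the Cauchy product f ⊛ (h ⊘ f) ≈ h.

reverseCoeffs : Series → ℕ → List ℚ
reverseCoeffs g zero = g 0 ∷ []
reverseCoeffs g (suc n) = g (suc n) ∷ reverseCoeffs g n

divRev≡reverseCoeffs : ∀ h f n → divRev h f n ≡ reverseCoeffs (h ⊘ f) n
divRev≡reverseCoeffs h f zero = refl
divRev≡reverseCoeffs h f (suc n) = cong (headQ (divRev h f (suc n)) ∷_) (divRev≡reverseCoeffs h f n)

map-applyUpTo : ∀ (g : ℕ → ℚ) (f : ℕ → ℕ) n → map g (applyUpTo f n) ≡ applyUpTo (λ i → g (f i)) n
map-applyUpTo g f zero = refl
map-applyUpTo g f (suc n) = cong (g (f 0) ∷_) (map-applyUpTo g (λ i → f (suc i)) n)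

⊛-as-sum : ∀ p g n → (p ⊛ g) n ≡ sumQ (zipWith _*_ (applyUpTo p (suc n)) (reverseCoeffs g n))
⊛-as-sum p g zero = sym (+-identityʳ _)
⊛-as-sum p g (suc n) = cong (p 0 * g (suc n) +_) (⊛-as-sum (tl p) g n)

⊘-suc : ∀ h f n → (h ⊘ f) (suc n) ≡ (h (suc n) - (tl f ⊛ (h ⊘ f)) n) * invQ (f 0)
⊘-suc h f n = cong (λ s → (h (suc n) - s) * invQ (f 0)) (sym (begin
  (tl f ⊛ (h ⊘ f)) n
    ≡⟨ ⊛-as-sum (tl f) (h ⊘ f) n ⟩
  sumQ (zipWith _*_ (applyUpTo (tl f) (suc n)) (reverseCoeffs (h ⊘ f) n))
    ≡⟨ cong₂ (λ u v → sumQ (zipWith _*_ u v))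
             (sym (map-applyUpTo (λ i → f (suc i)) (λ i → i) (suc n))) (sym (divRev≡reverseCoeffs h f n)) ⟩
  sumQ (zipWith _*_ (map (λ i → f (suc i)) (upTo (suc n))) (divRev h f n)) ∎))
  where open ≡-Reasoning

⊘-spec : ∀ h f → f 0 ≢ 0ℚ → f ⊛ (h ⊘ f) ≈ h
⊘-spec h f f0≢0 zero = begin
  f 0 * (h 0 * invQ (f 0))   ≡⟨ solve 3 (λ a b c → a :* (b :* c) := b :* (a :* c)) refl (f 0) (h 0) (invQ (f 0)) ⟩
  h 0 * (f 0 * invQ (f 0))   ≡⟨ cong (h 0 *_) (invQ-inverseʳ (f 0) f0≢0) ⟩
  h 0 * 1ℚ                   ≡⟨ *-identityʳ _ ⟩
  h 0                        ∎
  where open ≡-Reasoning; open ℚ-Solver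
⊘-spec h f f0≢0 (suc n) = begin
  f 0 * (h ⊘ f) (suc n) + S              ≡⟨ cong (λ u → f 0 * u + S) (⊘-suc h f n) ⟩
  f 0 * ((h (suc n) - S) * invQ (f 0)) + S
    ≡⟨ solve 4 (λ a b s i → a :* ((b :- s) :* i) :+ s := (b :- s) :* (a :* i) :+ s) refl (f 0) (h (suc n)) S (invQ (f 0)) ⟩
  (h (suc n) - S) * (f 0 * invQ (f 0)) + S ≡⟨ cong (λ u → (h (suc n) - S) * u + S) (invQ-inverseʳ (f 0) f0≢0) ⟩
  (h (suc n) - S) * 1ℚ + S               ≡⟨ solve 2 (λ b s → (b :- s) :* con 1ℚ :+ s := b) refl (h (suc n)) S ⟩
  h (suc n)                              ∎
  where
  open ≡-Reasoning; open ℚ-Solver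
  S = (tl f ⊛ (h ⊘ f)) n

Agree : ℕ → Series → Series → Set
Agree k f g = ∀ i → i ≤ k → f i ≡ g i

Agree-tl : ∀ {k f g} → Agree (suc k) f g → Agree k (tl f) (tl g)
Agree-tl a i i≤k = a (suc i) (s≤s i≤k)

Agree-≤ : ∀ {k k' f g} → k' ≤ k → Agree k f g → Agree k' f g
Agree-≤ le a i i≤k' = a i (ℕP.≤-trans i≤k' le)

Agree-pred : ∀ {k f g} → Agree (suc k) f g → Agree k f g
Agree-pred = Agree-≤ (ℕP.n≤1+n _)

⊛-local : ∀ k {f f' g g'} → Agree k f f' → Agree k g g' → (f ⊛ g) k ≡ (f' ⊛ g') k
⊛-local zero af ag = cong₂ _*_ (af 0 z≤n) (ag 0 z≤n)
⊛-local (suc k) af ag =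
  cong₂ _+_ (cong₂ _*_ (af 0 z≤n) (ag (suc k) ℕP.≤-refl)) (⊛-local k (Agree-tl af) (Agree-pred ag))

⊛-Agree : ∀ k {f f' g g'} → Agree k f f' → Agree k g g' → Agree k (f ⊛ g) (f' ⊛ g')
⊛-Agree k af ag i i≤k = ⊛-local i (Agree-≤ i≤k af) (Agree-≤ i≤k ag)

x-Agree : ∀ d {h h'} → Agree d h h' → Agree (suc d) (xS ⊛ h) (xS ⊛ h')
x-Agree d {h} {h'} ag zero _ = trans (x-coeff0 h) (sym (x-coeff0 h'))
x-Agree d {h} {h'} ag (suc i) (s≤s i≤d) = trans (x-coeffS h i) (trans (ag i i≤d) (sym (x-coeffS h' i)))

cancel-local : ∀ k {f f' g g'} → f 0 ≢ 0ℚ → Agree k f f' → Agree k (f ⊛ g) (f' ⊛ g') → Agree k g g'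
cancel-local zero f0≢0 af ap zero z≤n =
  *-cancelˡ-≢0 _ _ _ f0≢0 (trans (ap 0 z≤n) (cong (_* _) (sym (af 0 z≤n))))
cancel-local (suc k) {f} {f'} {g} {g'} f0≢0 af ap i i≤ with ℕP.m≤n⇒m<n∨m≡n i≤
... | inj₁ (s≤s i≤k) = below i i≤k
  where below = cancel-local k f0≢0 (Agree-pred af) (Agree-pred ap)
... | inj₂ refl = *-cancelˡ-≢0 (f 0) (g (suc k)) (g' (suc k)) f0≢0 leading
  where
  -- the remaining terms of (f ⊛ g)_{k+1} only involve g up to x^k
  rest : (tl f ⊛ g) k ≡ (tl f' ⊛ g') k
  rest = ⊛-local k (Agree-tl af) (cancel-local k f0≢0 (Agree-pred af) (Agree-pred ap))
  leading : f 0 * g (suc k) ≡ f 0 * g' (suc k)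
  leading = trans (GroupProperties.∙-cancelʳ +-0-group ((tl f ⊛ g) k) _ _
                     (trans (ap (suc k) ℕP.≤-refl) (cong (f' 0 * g' (suc k) +_) (sym rest))))
                  (cong (_* g' (suc k)) (sym (af 0 z≤n)))

cancel : ∀ {f g g'} → f 0 ≢ 0ℚ → f ⊛ g ≈ f ⊛ g' → g ≈ g'
cancel f0≢0 p n = cancel-local n f0≢0 (λ _ _ → refl) (λ i _ → p i) n ℕP.≤-refl

⊘-unique : ∀ {h f q} → f 0 ≢ 0ℚ → f ⊛ q ≈ h → q ≈ h ⊘ f
⊘-unique {h} {f} f0≢0 p = cancel f0≢0 (≈-trans p (≈-sym (⊘-spec h f f0≢0)))

⊘-cong : ∀ {h h' f f'} → f 0 ≢ 0ℚ → f' 0 ≢ 0ℚ → h ≈ h' → f ≈ f' → h ⊘ f ≈ h' ⊘ f'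
⊘-cong {h} {h'} {f} {f'} f0≢0 f'0≢0 p q =
  ⊘-unique f'0≢0 (≈-trans (⊛-congˡ (h ⊘ f) (≈-sym q)) (≈-trans (⊘-spec h f f0≢0) p))

⊘-congˡ : ∀ {h h' f} → f 0 ≢ 0ℚ → h ≈ h' → h ⊘ f ≈ h' ⊘ f
⊘-congˡ f0≢0 p = ⊘-cong f0≢0 f0≢0 p ≈-refl

⊘-local : ∀ k {h h' f f'} → f 0 ≢ 0ℚ → f' 0 ≢ 0ℚ → Agree k h h' → Agree k f f' → Agree k (h ⊘ f) (h' ⊘ f')
⊘-local k {h} {h'} {f} {f'} f0≢0 f'0≢0 ah af = cancel-local k f0≢0 af
  (λ i i≤ → trans (⊘-spec h f f0≢0 i) (trans (ah i i≤) (sym (⊘-spec h' f' f'0≢0 i))))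

⊘-at-0 : ∀ {h f} → h 0 ≡ 1ℚ → f 0 ≡ 1ℚ → (h ⊘ f) 0 ≡ 1ℚ
⊘-at-0 p q = cong₂ (λ u v → u * invQ v) p q

⊘-local-shift : ∀ r {h f f'} → h 0 ≡ 0ℚ → f 0 ≢ 0ℚ → f' 0 ≢ 0ℚ → Agree r f f' → Agree (suc r) (h ⊘ f) (h ⊘ f')
⊘-local-shift r {h} {f} {f'} h0 f0≢0 f'0≢0 ag i i≤ =
  trans (sym (shift f f0≢0 i))
    (trans (x-Agree r (⊘-local r f0≢0 f'0≢0 (λ _ _ → refl) ag) i i≤) (shift f' f'0≢0 i))
  where
  shift : ∀ g → g 0 ≢ 0ℚ → xS ⊛ (tl h ⊘ g) ≈ h ⊘ g
  shift g g0≢0 = ⊘-unique g0≢0 (begin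
    g ⊛ (xS ⊛ (tl h ⊘ g))   ≈⟨ solve 3 (λ G X Y → G :* (X :* Y) := X :* (G :* Y)) ≈-refl g xS (tl h ⊘ g) ⟩
    xS ⊛ (g ⊛ (tl h ⊘ g))   ≈⟨ ⊛-congʳ xS (⊘-spec (tl h) g g0≢0) ⟩
    xS ⊛ tl h               ≈⟨ ≈-sym (x-factor h0) ⟩
    h                       ∎)
    where open ≈-Reasoning; open S-Solver

continued-fraction-step : ∀ {N D N' D' β α} → D 0 ≢ 0ℚ → N' 0 ≢ 0ℚ → D' 0 ≢ 0ℚ →
  N ⊛ N' ≈ D ⊛ (β ⊛ N' ⊕ α ⊛ D') → N ⊘ D ≈ β ⊕ α ⊘ (N' ⊘ D')
continued-fraction-step {N} {D} {N'} {D'} {β} {α} D0≢0 N'0≢0 D'0≢0 identity =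
  ≈-sym (⊘-unique D0≢0 (cancel N'0≢0 (begin
    N' ⊛ (D ⊛ (β ⊕ Y))        ≈⟨ solve 4 (λ n d b y → n :* (d :* (b :+ y)) := d :* (b :* n) :+ d :* (n :* y)) ≈-refl N' D β Y ⟩
    D ⊛ (β ⊛ N') ⊕ D ⊛ (N' ⊛ Y) ≈⟨ ⊕-congʳ (D ⊛ (β ⊛ N')) (⊛-congʳ D N'Y≈αD') ⟩
    D ⊛ (β ⊛ N') ⊕ D ⊛ (α ⊛ D') ≈⟨ solve 4 (λ d b n e → d :* (b :* n) :+ d :* e := d :* (b :* n :+ e)) ≈-refl D β N' (α ⊛ D') ⟩
    D ⊛ (β ⊛ N' ⊕ α ⊛ D')     ≈⟨ ≈-sym identity ⟩
    N ⊛ N'                    ≈⟨ ⊛-comm N N' ⟩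
    N' ⊛ N                    ∎)))
  where
  open ≈-Reasoning; open S-Solver
  T' = N' ⊘ D'
  Y = α ⊘ T'
  D'T'≈N' : D' ⊛ T' ≈ N'
  D'T'≈N' = ⊘-spec N' D' D'0≢0
  T'0≢0 : T' 0 ≢ 0ℚ
  T'0≢0 t0 = N'0≢0 (trans (sym (D'T'≈N' 0)) (trans (cong (D' 0 *_) t0) (*-zeroʳ (D' 0))))
  N'Y≈αD' : N' ⊛ Y ≈ α ⊛ D'
  N'Y≈αD' = begin
    N' ⊛ Y           ≈⟨ ⊛-congˡ Y (≈-sym D'T'≈N') ⟩
    D' ⊛ T' ⊛ Y      ≈⟨ ⊛-assoc D' T' Y ⟩
    D' ⊛ (T' ⊛ Y)    ≈⟨ ⊛-congʳ D' (⊘-spec α T' T'0≢0) ⟩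
    D' ⊛ α           ≈⟨ ⊛-comm D' α ⟩
    α ⊛ D'           ∎

D : Series → Series
D f n = ℕtoℚ (suc n) * f (suc n)

D-cong : ∀ {f g} → f ≈ g → D f ≈ D g
D-cong p n = cong (ℕtoℚ (suc n) *_) (p (suc n))

D-⊕ : ∀ f g → D (f ⊕ g) ≈ D f ⊕ D g
D-⊕ f g n = *-distribˡ-+ (ℕtoℚ (suc n)) (f (suc n)) (g (suc n))

D-negS : ∀ f → D (negS f) ≈ negS (D f)
D-negS f n = sym (neg-distribʳ-* (ℕtoℚ (suc n)) (f (suc n)))

D-κ : ∀ c → D (κ c) ≈ 0S
D-κ c n = *-zeroʳ (ℕtoℚ (suc n))

-- tl commutes with D up to the extra term coming from (n+2) = (n+1) + 1
tl-D : ∀ f → tl (D f) ≈ D (tl f) ⊕ tl (tl f)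
tl-D f k = begin
  ℕtoℚ (suc (suc k)) * f (suc (suc k))     ≡⟨ cong (_* f (suc (suc k))) (ℕtoℚ-suc (suc k)) ⟩
  (1ℚ + ℕtoℚ (suc k)) * f (suc (suc k))    ≡⟨ solve 2 (λ a b → (con 1ℚ :+ a) :* b := a :* b :+ b) refl (ℕtoℚ (suc k)) (f (suc (suc k))) ⟩
  ℕtoℚ (suc k) * f (suc (suc k)) + f (suc (suc k)) ∎
  where open ≡-Reasoning; open ℚ-Solver

D-⊛ : ∀ f g → D (f ⊛ g) ≈ D f ⊛ g ⊕ f ⊛ D g
D-⊛ f g zero = solve 4 (λ a b c d → con 1ℚ :* (a :* b :+ c :* d) := con 1ℚ :* c :* d :+ a :* (con 1ℚ :* b)) refl
                 (f 0) (g 1) (f 1) (g 0)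
  where open ℚ-Solver
D-⊛ f g (suc m) = begin
  ℕtoℚ (suc (suc m)) * (f 0 * g (suc (suc m)) + S)
    ≡⟨ cong (λ u → u * (f 0 * g (suc (suc m)) + S)) (ℕtoℚ-suc (suc m)) ⟩
  (1ℚ + N) * (f 0 * g (suc (suc m)) + S)
    ≡⟨ solve 5 (λ n a b t s → (con 1ℚ :+ n) :* (a :* b :+ s)
                   := (t :+ n :* s) :+ (a :* ((con 1ℚ :+ n) :* b)) :+ (s :- t))
             refl N (f 0) (g (suc (suc m))) T S ⟩
  (T + N * S) + f 0 * ((1ℚ + N) * g (suc (suc m))) + (S - T)
    ≡⟨ cong₂ (λ u v → (T + u) + f 0 * v + (S - T)) (D-⊛ (tl f) g m)
             (cong (_* g (suc (suc m))) (sym (ℕtoℚ-suc (suc m)))) ⟩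
  (T + (A + B)) + f 0 * D g (suc m) + ((f 1 * g (suc m) + T) - T)
    ≡⟨ solve 5 (λ t a b c d → (t :+ (a :+ b)) :+ c :+ ((d :+ t) :- t) := (d :+ (a :+ t)) :+ (c :+ b))
             refl T A B (f 0 * D g (suc m)) (f 1 * g (suc m)) ⟩
  (f 1 * g (suc m) + (A + T)) + (f 0 * D g (suc m) + B)
    ≡⟨ cong (λ u → (f 1 * g (suc m) + u) + (f 0 * D g (suc m) + B)) (sym (⊛-distribʳ (D (tl f)) (tl (tl f)) g m)) ⟩
  (f 1 * g (suc m) + ((D (tl f) ⊕ tl (tl f)) ⊛ g) m) + (f 0 * D g (suc m) + B)
    ≡⟨ cong₂ (λ w u → (w * g (suc m) + u) + (f 0 * D g (suc m) + B))
             (sym (*-identityˡ (f 1))) (⊛-congˡ g (≈-sym (tl-D f)) m) ⟩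
  (D f ⊛ g) (suc m) + (f ⊛ D g) (suc m) ∎
  where
  open ≡-Reasoning; open ℚ-Solver
  N = ℕtoℚ (suc m)
  S = (tl f ⊛ g) (suc m)       -- = f₁ g_{m+1} + T
  T = (tl (tl f) ⊛ g) m
  A = (D (tl f) ⊛ g) m
  B = (tl f ⊛ D g) m

D≈0⇒constant : ∀ f → D f ≈ 0S → f ≈ κ (f 0)
D≈0⇒constant f p zero = refl
D≈0⇒constant f p (suc n) =
  *-cancelˡ-≢0 (ℕtoℚ (suc n)) _ _ (ℕtoℚ-suc≢0 n) (trans (p n) (sym (*-zeroʳ (ℕtoℚ (suc n)))))

double : ℕ → ℕ
double zero = zero
double (suc k) = suc (suc (double k))

parity : ∀ n → Σ ℕ (λ k → n ≡ double k ⊎ n ≡ suc (double k))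
parity zero = zero , inj₁ refl
parity (suc n) with parity n
... | k , inj₁ refl = k , inj₂ refl
... | k , inj₂ refl = suc k , inj₁ refl

double%2 : ∀ k → double k % 2 ≡ 0
double%2 zero = refl
double%2 (suc k) = double%2 k

double+1%2 : ∀ k → suc (double k) % 2 ≡ 1
double+1%2 zero = refl
double+1%2 (suc k) = double+1%2 k

double/2 : ∀ k → double k / 2 ≡ k
double/2 zero = refl
double/2 (suc k) = trans (ℕDM.m/n≡1+[m∸n]/n {suc (suc (double k))} {2} (s≤s (s≤s z≤n))) (cong suc (double/2 k))

double+1/2 : ∀ k → suc (double k) / 2 ≡ k
double+1/2 zero = refl
double+1/2 (suc k) = trans (ℕDM.m/n≡1+[m∸n]/n {suc (suc (suc (double k)))} {2} (s≤s (s≤s z≤n))) (cong suc (double+1/2 k))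

sign : ℕ → ℚ
sign k = if k % 2 ℕ.≡ᵇ 0 then 1ℚ else - 1ℚ

sign-suc : ∀ k → sign (suc k) ≡ - sign k
sign-suc zero = refl
sign-suc (suc zero) = refl
sign-suc (suc (suc k)) = sign-suc k

invFact : ℕ → ℚ
invFact n = invQ (ℕtoℚ (n ℕ.!))

fact≢0 : ∀ n → ℕtoℚ (n ℕ.!) ≢ 0ℚ
fact≢0 n eq with n ℕ.! | ℕP._!≢0 n
... | zero | n!≢0 = ℕ.≢-nonZero⁻¹ 0 {{n!≢0}} refl
... | suc m | _ = ℕtoℚ-suc≢0 m eq

invFact-suc : ∀ n → ℕtoℚ (suc n) * invFact (suc n) ≡ invFact n
invFact-suc n = sym (invQ-unique (ℕtoℚ (n ℕ.!)) _ (begin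
  ℕtoℚ (n ℕ.!) * (ℕtoℚ (suc n) * invFact (suc n))
    ≡⟨ solve 3 (λ a b c → a :* (b :* c) := (b :* a) :* c) refl (ℕtoℚ (n ℕ.!)) (ℕtoℚ (suc n)) (invFact (suc n)) ⟩
  (ℕtoℚ (suc n) * ℕtoℚ (n ℕ.!)) * invFact (suc n)
    ≡⟨ cong (_* invFact (suc n)) (sym (ℕtoℚ-* (suc n) (n ℕ.!))) ⟩
  ℕtoℚ (suc n ℕ.!) * invFact (suc n)
    ≡⟨ invQ-inverseʳ _ (fact≢0 (suc n)) ⟩
  1ℚ ∎))
  where open ≡-Reasoning; open ℚ-Solver

sin-odd : ∀ k → sinS (suc (double k)) ≡ sign k * invFact (suc (double k))
sin-odd k = trans (at (suc (double k)) (double+1%2 k)) (cong (λ j → sign j * invFact (suc (double k))) (double+1/2 k))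
  where
  at : ∀ n → n % 2 ≡ 1 → sinS n ≡ sign (n / 2) * invFact n
  at n eq with n % 2
  at n refl | .1 = refl

sin-even : ∀ k → sinS (double k) ≡ 0ℚ
sin-even k = at (double k) (double%2 k)
  where
  at : ∀ n → n % 2 ≡ 0 → sinS n ≡ 0ℚ
  at n eq with n % 2
  at n refl | .0 = refl

cos-even : ∀ k → cosS (double k) ≡ sign k * invFact (double k)
cos-even k = trans (at (double k) (double%2 k)) (cong (λ j → sign j * invFact (double k)) (double/2 k))
  where
  at : ∀ n → n % 2 ≡ 0 → cosS n ≡ sign (n / 2) * invFact n
  at n eq with n % 2
  at n refl | .0 = refl

cos-odd : ∀ k → cosS (suc (double k)) ≡ 0ℚ
cos-odd k = at (suc (double k)) (double+1%2 k)
  where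
  at : ∀ n → n % 2 ≡ 1 → cosS n ≡ 0ℚ
  at n eq with n % 2
  at n refl | .1 = refl

D-term : ∀ s n → ℕtoℚ (suc n) * (s * invFact (suc n)) ≡ s * invFact n
D-term s n = trans (solve 3 (λ a b c → a :* (b :* c) := b :* (a :* c)) refl (ℕtoℚ (suc n)) s (invFact (suc n)))
                   (cong (s *_) (invFact-suc n))
  where open ℚ-Solver

D-sin : D sinS ≈ cosS
D-sin n with parity n
... | k , inj₁ refl = begin
  ℕtoℚ (suc (double k)) * sinS (suc (double k))              ≡⟨ cong (ℕtoℚ (suc (double k)) *_) (sin-odd k) ⟩
  ℕtoℚ (suc (double k)) * (sign k * invFact (suc (double k))) ≡⟨ D-term (sign k) (double k) ⟩
  sign k * invFact (double k)                                ≡⟨ sym (cos-even k) ⟩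
  cosS (double k)                                            ∎
  where open ≡-Reasoning
... | k , inj₂ refl =
  trans (cong (ℕtoℚ (suc (suc (double k))) *_) (sin-even (suc k)))
        (trans (*-zeroʳ (ℕtoℚ (suc (suc (double k))))) (sym (cos-odd k)))

D-cos : D cosS ≈ negS sinS
D-cos n with parity n
... | k , inj₁ refl =
  trans (cong (ℕtoℚ (suc (double k)) *_) (cos-odd k))
        (trans (*-zeroʳ (ℕtoℚ (suc (double k)))) (cong -_ (sym (sin-even k))))
... | k , inj₂ refl = begin
  ℕtoℚ (suc (suc (double k))) * cosS (double (suc k))
    ≡⟨ cong (ℕtoℚ (suc (suc (double k))) *_) (cos-even (suc k)) ⟩
  ℕtoℚ (suc (suc (double k))) * (sign (suc k) * invFact (suc (suc (double k))))
    ≡⟨ D-term (sign (suc k)) (suc (double k)) ⟩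
  sign (suc k) * invFact (suc (double k))  ≡⟨ cong (_* invFact (suc (double k))) (sign-suc k) ⟩
  - sign k * invFact (suc (double k))      ≡⟨ sym (neg-distribˡ-* (sign k) _) ⟩
  - (sign k * invFact (suc (double k)))    ≡⟨ cong -_ (sym (sin-odd k)) ⟩
  - sinS (suc (double k))                  ∎
  where open ≡-Reasoning

-- Expressions used both as series and, inside the ring solver, as
-- polynomials: they are written once over an arbitrary signature of ring
-- operations and instantiated twice.

module RingExpressions {A : Set} (add mul : A → A → A) (neg : A → A) (const : ℚ → A) where
  private
    infixl 6 _+ᴿ_ _−ᴿ_
    infixl 7 _*ᴿ_
    _+ᴿ_ _*ᴿ_ _−ᴿ_ : A → A → A
    p +ᴿ q = add p q
    p *ᴿ q = mul p q
    p −ᴿ q = add p (neg q)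

  n̂ : ℕ → A
  n̂ k = const (ℕtoℚ k)

  pow : A → ℕ → A
  pow p zero = const 1ℚ
  pow p (suc d) = p *ᴿ pow p d

  lin : ℕ → ℕ → A → A
  lin p q m = n̂ p *ᴿ m +ᴿ n̂ q

  Δ : (k x g : A) → A
  Δ k x g = const 1ℚ −ᴿ (k *ᴿ x +ᴿ const ½ *ᴿ k *ᴿ (k +ᴿ const 1ℚ) *ᴿ (x *ᴿ (x *ᴿ g)))

open RingExpressions _⊕_ _⊛_ negS κ

diff≈0 : ∀ {f g} → f ≈ g → f ⊕ negS g ≈ κ 0ℚ
diff≈0 {f} {g} p zero = trans (cong (_+ - g 0) (p 0)) (+-inverseʳ (g 0))
diff≈0 {f} {g} p (suc n) = trans (cong (_+ - g (suc n)) (p (suc n))) (+-inverseʳ (g (suc n)))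

F : Series
F = tanPlusSec

cos-F : cosS ⊛ F ≈ sinS ⊕ 1S
cos-F = ⊘-spec (sinS ⊕ 1S) cosS (λ ())

sin²+cos² : sinS ⊛ sinS ⊕ cosS ⊛ cosS ≈ 1S
sin²+cos² = ≈-trans (D≈0⇒constant _ derivative≈0) (λ { zero → refl ; (suc n) → refl })
  where
  open ≈-Reasoning; open S-Solver
  derivative≈0 : D (sinS ⊛ sinS ⊕ cosS ⊛ cosS) ≈ 0S
  derivative≈0 = begin
    D (sinS ⊛ sinS ⊕ cosS ⊛ cosS)
      ≈⟨ ≈-trans (D-⊕ (sinS ⊛ sinS) (cosS ⊛ cosS)) (⊕-cong (D-⊛ sinS sinS) (D-⊛ cosS cosS)) ⟩
    (D sinS ⊛ sinS ⊕ sinS ⊛ D sinS) ⊕ (D cosS ⊛ cosS ⊕ cosS ⊛ D cosS)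
      ≈⟨ ⊕-cong (⊕-cong (⊛-congˡ sinS D-sin) (⊛-congʳ sinS D-sin)) (⊕-cong (⊛-congˡ cosS D-cos) (⊛-congʳ cosS D-cos)) ⟩
    (cosS ⊛ sinS ⊕ sinS ⊛ cosS) ⊕ (negS sinS ⊛ cosS ⊕ cosS ⊛ negS sinS)
      ≈⟨ solve 2 (λ s c → (c :* s :+ s :* c) :+ ((:- s) :* c :+ c :* (:- s)) := con 0ℚ) ≈-refl sinS cosS ⟩
    κ 0ℚ ≈⟨ κ-0 ⟩
    0S ∎

-- derivative of cos · F = 1 + sin
D-cos-F : negS sinS ⊛ F ⊕ cosS ⊛ D F ≈ cosS
D-cos-F = begin
  negS sinS ⊛ F ⊕ cosS ⊛ D F ≈⟨ ⊕-cong (⊛-congˡ F (≈-sym D-cos)) ≈-refl ⟩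
  D cosS ⊛ F ⊕ cosS ⊛ D F    ≈⟨ ≈-sym (D-⊛ cosS F) ⟩
  D (cosS ⊛ F)               ≈⟨ D-cong cos-F ⟩
  D (sinS ⊕ 1S)              ≈⟨ ≈-trans (D-⊕ sinS 1S) (⊕-cong D-sin (≈-trans (D-κ 1ℚ) (≈-sym κ-0))) ⟩
  cosS ⊕ κ 0ℚ                ≈⟨ solve 1 (λ c → c :+ con 0ℚ := c) ≈-refl cosS ⟩
  cosS                       ∎
  where open ≈-Reasoning; open S-Solver

riccati : D F ≈ κ ½ ⊛ (1S ⊕ F ⊛ F)
riccati = begin
  D F                      ≈⟨ solve 1 (λ d → d := con ½ :* (con (ℕtoℚ 2) :* d)) ≈-refl (D F) ⟩
  κ ½ ⊛ (κ (ℕtoℚ 2) ⊛ D F) ≈⟨ ⊛-congʳ (κ ½) (cancel {f = cosS ⊛ cosS} (λ ()) cos²-identity) ⟩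
  κ ½ ⊛ (1S ⊕ F ⊛ F)       ∎
  where
  open ≈-Reasoning; open S-Solver
  -- cos² (2 D F - 1 - F²) is a combination of the three relations above
  cos²-identity : cosS ⊛ cosS ⊛ (κ (ℕtoℚ 2) ⊛ D F) ≈ cosS ⊛ cosS ⊛ (1S ⊕ F ⊛ F)
  cos²-identity = begin
    cosS ⊛ cosS ⊛ (κ (ℕtoℚ 2) ⊛ D F)
      ≈⟨ solve 4 (λ c s f d →
            c :* c :* (con (ℕtoℚ 2) :* d)
            := c :* c :* (con 1ℚ :+ f :* f)
               :+ (con (ℕtoℚ 2) :* c :* (((:- s) :* f :+ c :* d) :- c)
                   :- (c :* f :- (s :+ con 1ℚ)) :* (c :* f :- (s :+ con 1ℚ))
                   :- con (ℕtoℚ 2) :* (c :* f :- (s :+ con 1ℚ))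
                   :+ ((s :* s :+ c :* c) :- con 1ℚ))) ≈-refl cosS sinS F (D F) ⟩
    cosS ⊛ cosS ⊛ (1S ⊕ F ⊛ F)
      ⊕ (κ (ℕtoℚ 2) ⊛ cosS ⊛ ((negS sinS ⊛ F ⊕ cosS ⊛ D F) ⊕ negS cosS)
         ⊕ negS ((cosS ⊛ F ⊕ negS (sinS ⊕ 1S)) ⊛ (cosS ⊛ F ⊕ negS (sinS ⊕ 1S)))
         ⊕ negS (κ (ℕtoℚ 2) ⊛ (cosS ⊛ F ⊕ negS (sinS ⊕ 1S)))
         ⊕ ((sinS ⊛ sinS ⊕ cosS ⊛ cosS) ⊕ negS 1S))
      ≈⟨ ⊕-congʳ (cosS ⊛ cosS ⊛ (1S ⊕ F ⊛ F))
           (⊕-cong (⊕-cong (⊕-cong (⊛-congʳ (κ (ℕtoℚ 2) ⊛ cosS) (diff≈0 D-cos-F))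
                                   (negS-cong (⊛-cong (diff≈0 cos-F) (diff≈0 cos-F))))
                           (negS-cong (⊛-congʳ (κ (ℕtoℚ 2)) (diff≈0 cos-F))))
                   (diff≈0 sin²+cos²)) ⟩
    cosS ⊛ cosS ⊛ (1S ⊕ F ⊛ F)
      ⊕ (κ (ℕtoℚ 2) ⊛ cosS ⊛ κ 0ℚ ⊕ negS (κ 0ℚ ⊛ κ 0ℚ) ⊕ negS (κ (ℕtoℚ 2) ⊛ κ 0ℚ) ⊕ κ 0ℚ)
      ≈⟨ solve 2 (λ c f → c :* c :* (con 1ℚ :+ f :* f)
                          :+ (con (ℕtoℚ 2) :* c :* con 0ℚ :- con 0ℚ :* con 0ℚ :- con (ℕtoℚ 2) :* con 0ℚ :+ con 0ℚ)
                          := c :* c :* (con 1ℚ :+ f :* f)) ≈-refl cosS F ⟩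
    cosS ⊛ cosS ⊛ (1S ⊕ F ⊛ F) ∎

modulo₁ : ∀ {L R p} u → p ≈ 1S → L ≈ R ⊕ (p ⊕ negS 1S) ⊛ u → L ≈ R
modulo₁ {L} {R} {p} u hp e = begin
  L                            ≈⟨ e ⟩
  R ⊕ (p ⊕ negS 1S) ⊛ u        ≈⟨ ⊕-congʳ R (⊛-congˡ u (diff≈0 hp)) ⟩
  R ⊕ κ 0ℚ ⊛ u                 ≈⟨ solve 2 (λ r v → r :+ con 0ℚ :* v := r) ≈-refl R u ⟩
  R                            ∎
  where open ≈-Reasoning; open S-Solver

modulo₂ : ∀ {L R p q} u v → p ≈ 1S → q ≈ 1S → L ≈ R ⊕ ((p ⊕ negS 1S) ⊛ u ⊕ (q ⊕ negS 1S) ⊛ v) → L ≈ R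
modulo₂ {L} {R} {p} {q} u v hp hq e = begin
  L                                              ≈⟨ e ⟩
  R ⊕ ((p ⊕ negS 1S) ⊛ u ⊕ (q ⊕ negS 1S) ⊛ v)    ≈⟨ ⊕-congʳ R (⊕-cong (⊛-congˡ u (diff≈0 hp)) (⊛-congˡ v (diff≈0 hq))) ⟩
  R ⊕ (κ 0ℚ ⊛ u ⊕ κ 0ℚ ⊛ v)                      ≈⟨ solve 3 (λ r a b → r :+ (con 0ℚ :* a :+ con 0ℚ :* b) := r) ≈-refl R u v ⟩
  R                                              ∎
  where open ≈-Reasoning; open S-Solver

n̂-+ : ∀ m n → n̂ (m ℕ.+ n) ≈ n̂ m ⊕ n̂ n
n̂-+ m n = ≈-trans (κ-cong (ℕtoℚ-+ m n)) (κ-+ (ℕtoℚ m) (ℕtoℚ n))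

n̂-* : ∀ m n → n̂ (m ℕ.* n) ≈ n̂ m ⊛ n̂ n
n̂-* m n = ≈-trans (κ-cong (ℕtoℚ-* m n)) (κ-* (ℕtoℚ m) (ℕtoℚ n))

n̂-suc : ∀ k → n̂ (suc k) ≈ 1S ⊕ n̂ k
n̂-suc k = ≈-trans (κ-cong (ℕtoℚ-suc k)) (κ-+ 1ℚ (ℕtoℚ k))

w : Series
w = F ⊕ negS 1S

D-w : D w ≈ 1S ⊕ w ⊕ κ ½ ⊛ (w ⊛ w)
D-w = begin
  D w                              ≈⟨ D-⊕ F (negS 1S) ⟩
  D F ⊕ D (negS 1S)                ≈⟨ ⊕-cong riccati (≈-trans (D-negS 1S) (negS-cong (≈-trans (D-κ 1ℚ) (≈-sym κ-0)))) ⟩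
  κ ½ ⊛ (1S ⊕ F ⊛ F) ⊕ negS (κ 0ℚ)
    ≈⟨ solve 1 (λ f → con ½ :* (con 1ℚ :+ f :* f) :+ :- con 0ℚ
                      := con 1ℚ :+ (f :- con 1ℚ) :+ con ½ :* ((f :- con 1ℚ) :* (f :- con 1ℚ))) ≈-refl F ⟩
  1S ⊕ w ⊕ κ ½ ⊛ (w ⊛ w)           ∎
  where open ≈-Reasoning; open S-Solver

D-pow : ∀ f k → D (pow f (suc k)) ≈ n̂ (suc k) ⊛ pow f k ⊛ D f
D-pow f zero = begin
  D (f ⊛ 1S)                   ≈⟨ ≈-trans (D-⊛ f 1S) (⊕-congʳ (D f ⊛ 1S) (⊛-congʳ f (≈-trans (D-κ 1ℚ) (≈-sym κ-0)))) ⟩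
  D f ⊛ 1S ⊕ f ⊛ κ 0ℚ          ≈⟨ solve 2 (λ d v → d :* con 1ℚ :+ v :* con 0ℚ := con 1ℚ :* con 1ℚ :* d) ≈-refl (D f) f ⟩
  n̂ 1 ⊛ 1S ⊛ D f               ∎
  where open ≈-Reasoning; open S-Solver
D-pow f (suc k) = begin
  D (f ⊛ pow f (suc k))                              ≈⟨ D-⊛ f (pow f (suc k)) ⟩
  D f ⊛ pow f (suc k) ⊕ f ⊛ D (pow f (suc k))        ≈⟨ ⊕-congʳ (D f ⊛ pow f (suc k)) (⊛-congʳ f (D-pow f k)) ⟩
  D f ⊛ (f ⊛ pow f k) ⊕ f ⊛ (n̂ (suc k) ⊛ pow f k ⊛ D f)
    ≈⟨ solve 4 (λ d v W A → d :* (v :* W) :+ v :* (A :* W :* d) := (con 1ℚ :+ A) :* (v :* W) :* d) ≈-refl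
         (D f) f (pow f k) (n̂ (suc k)) ⟩
  (1S ⊕ n̂ (suc k)) ⊛ pow f (suc k) ⊛ D f             ≈⟨ ⊛-congˡ (D f) (⊛-congˡ (pow f (suc k)) (≈-sym (n̂-suc (suc k)))) ⟩
  n̂ (suc (suc k)) ⊛ pow f (suc k) ⊛ D f              ∎
  where open ≈-Reasoning; open S-Solver

D-pow-w : ∀ k → D (pow w (suc k)) ≈ n̂ (suc k) ⊛ (pow w k ⊕ pow w (suc k) ⊕ κ ½ ⊛ pow w (suc (suc k)))
D-pow-w k = begin
  D (pow w (suc k))                         ≈⟨ D-pow w k ⟩
  n̂ (suc k) ⊛ pow w k ⊛ D w                 ≈⟨ ⊛-congʳ (n̂ (suc k) ⊛ pow w k) D-w ⟩
  n̂ (suc k) ⊛ pow w k ⊛ (1S ⊕ w ⊕ κ ½ ⊛ (w ⊛ w))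
    ≈⟨ solve 3 (λ A W v → A :* W :* (con 1ℚ :+ v :+ con ½ :* (v :* v))
                          := A :* (W :+ v :* W :+ con ½ :* (v :* (v :* W)))) ≈-refl (n̂ (suc k)) (pow w k) w ⟩
  n̂ (suc k) ⊛ (pow w k ⊕ pow w (suc k) ⊕ κ ½ ⊛ pow w (suc (suc k))) ∎
  where open ≈-Reasoning; open S-Solver

-- Tables P k n obeying the recurrence of Motzkin paths from height k to 0
-- with n steps, where a step from height k+1 is weighted by (k+1) (down),
-- (k+1) (level) or (k+1)/2 (up).

record MotzkinTable (P : ℕ → ℕ → ℚ) : Set where
  field
    origin : P 0 0 ≡ 1ℚ
    start-high : ∀ k → P (suc k) 0 ≡ 0ℚ
    stay-low : ∀ n → P 0 (suc n) ≡ 0ℚ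
    step : ∀ k n → P (suc k) (suc n) ≡ ℕtoℚ (suc k) * (P k n + P (suc k) n + ½ * P (suc (suc k)) n)

MotzkinTable-unique : ∀ {P P'} → MotzkinTable P → MotzkinTable P' → ∀ n k → P k n ≡ P' k n
MotzkinTable-unique t t' zero zero = trans (MotzkinTable.origin t) (sym (MotzkinTable.origin t'))
MotzkinTable-unique t t' zero (suc k) = trans (MotzkinTable.start-high t k) (sym (MotzkinTable.start-high t' k))
MotzkinTable-unique t t' (suc n) zero = trans (MotzkinTable.stay-low t n) (sym (MotzkinTable.stay-low t' n))
MotzkinTable-unique t t' (suc n) (suc k) =
  trans (MotzkinTable.step t k n)
    (trans (cong (λ u → ℕtoℚ (suc k) * u)
             (cong₂ _+_ (cong₂ _+_ (IH k) (IH (suc k))) (cong (½ *_) (IH (suc (suc k))))))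
      (sym (MotzkinTable.step t' k n)))
  where IH = MotzkinTable-unique t t' n

V : ℕ → ℕ → ℚ
V k n = ℕtoℚ (n ℕ.!) * pow w k n

coeff-step : ∀ α f g h n → (κ α ⊛ (f ⊕ g ⊕ κ ½ ⊛ h)) n ≡ α * (f n + g n + ½ * h n)
coeff-step α f g h n = trans (κ-coeff α (f ⊕ g ⊕ κ ½ ⊛ h) n) (cong (λ u → α * (f n + g n + u)) (κ-coeff ½ h n))

V-table : MotzkinTable V
V-table = record
  { origin = refl
  ; start-high = λ k → trans (cong (1ℚ *_) (*-zeroˡ (pow w k 0))) (*-zeroʳ 1ℚ)
  ; stay-low = λ n → *-zeroʳ (ℕtoℚ (suc n ℕ.!))
  ; step = step }
  where
  step : ∀ k n → V (suc k) (suc n) ≡ ℕtoℚ (suc k) * (V k n + V (suc k) n + ½ * V (suc (suc k)) n)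
  step k n = begin
    ℕtoℚ (suc n ℕ.!) * pow w (suc k) (suc n)
      ≡⟨ cong (_* pow w (suc k) (suc n)) (ℕtoℚ-* (suc n) (n ℕ.!)) ⟩
    (ℕtoℚ (suc n) * n!) * pow w (suc k) (suc n)
      ≡⟨ solve 3 (λ a b c → (a :* b) :* c := b :* (a :* c)) refl (ℕtoℚ (suc n)) n! (pow w (suc k) (suc n)) ⟩
    n! * D (pow w (suc k)) n
      ≡⟨ cong (n! *_) (trans (D-pow-w k n) (coeff-step (ℕtoℚ (suc k)) (pow w k) (pow w (suc k)) (pow w (suc (suc k))) n)) ⟩
    n! * (α * (pow w k n + pow w (suc k) n + ½ * pow w (suc (suc k)) n))
      ≡⟨ solve 6 (λ f a h x y z → f :* (a :* (x :+ y :+ h :* z)) := a :* (f :* x :+ f :* y :+ h :* (f :* z))) refl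
           n! α ½ (pow w k n) (pow w (suc k) n) (pow w (suc (suc k)) n) ⟩
    α * (V k n + V (suc k) n + ½ * V (suc (suc k)) n) ∎
    where
    open ≡-Reasoning; open ℚ-Solver
    n! = ℕtoℚ (n ℕ.!)
    α = ℕtoℚ (suc k)

E≡V0+V1 : ∀ n → E n ≡ V 0 n + V 1 n
E≡V0+V1 n = begin
  ℕtoℚ (n ℕ.!) * F n                          ≡⟨ cong (ℕtoℚ (n ℕ.!) *_) F≡1+w ⟩
  ℕtoℚ (n ℕ.!) * (1S n + w n)                 ≡⟨ *-distribˡ-+ (ℕtoℚ (n ℕ.!)) (1S n) (w n) ⟩
  V 0 n + ℕtoℚ (n ℕ.!) * w n
    ≡⟨ cong (λ u → V 0 n + ℕtoℚ (n ℕ.!) * u) (sym (CommutativeRing.*-identityʳ seriesRing w n)) ⟩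
  V 0 n + V 1 n                               ∎
  where
  open ≡-Reasoning
  F≡1+w : F n ≡ 1S n + w n
  F≡1+w = ℚ-Solver.solve 2 (λ f o → f ℚ-Solver.:= o ℚ-Solver.:+ (f ℚ-Solver.:- o)) refl (F n) (1S n)

-- The J-fraction  G_k = 1/(1 - k x - k(k+1)/2 x² G_{k+1}).  Its finite
-- truncations (G_{k+d} replaced by 1) stabilise coefficientwise; G_k is the
-- diagonal limit and satisfies G_k · Δ_k = 1.

Δ-at-0 : ∀ k g → Δ k xS g 0 ≡ 1ℚ
Δ-at-0 k g = cong (λ u → 1ℚ + - u)
  (trans (cong₂ _+_ (*-zeroʳ (k 0)) (x-multiple0 (κ ½ ⊛ k ⊛ (k ⊕ κ 1ℚ)) (xS ⊛ g))) (+-identityʳ 0ℚ))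

Δ-Agree : ∀ d k {g g'} → Agree d g g' → Agree (suc d) (Δ k xS g) (Δ k xS g')
Δ-Agree d k {g} {g'} ag i i≤ = cong (λ u → 1S i + - ((k ⊛ xS) i + u))
  (⊛-Agree (suc d) {κ ½ ⊛ k ⊛ (k ⊕ κ 1ℚ)} (λ _ _ → refl) (Agree-pred (x-Agree (suc d) (x-Agree d ag))) i i≤)

Δ≢0 : ∀ k g → Δ k xS g 0 ≢ 0ℚ
Δ≢0 k g = ≡1⇒≢0 (Δ-at-0 k g)

Gtrunc : ℕ → ℕ → Series
Gtrunc zero k = 1S
Gtrunc (suc d) k = 1S ⊘ Δ (n̂ k) xS (Gtrunc d (suc k))

Gtrunc-step : ∀ d k → Agree d (Gtrunc d k) (Gtrunc (suc d) k)
Gtrunc-step zero k zero z≤n = sym (⊘-at-0 {1S} {Δ (n̂ k) xS 1S} refl (Δ-at-0 (n̂ k) 1S))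
Gtrunc-step (suc d) k =
  ⊘-local (suc d) (Δ≢0 (n̂ k) (Gtrunc d (suc k))) (Δ≢0 (n̂ k) (Gtrunc (suc d) (suc k)))
    (λ _ _ → refl) (Δ-Agree d (n̂ k) (Gtrunc-step d (suc k)))

Gtrunc-stable : ∀ e d k → Agree d (Gtrunc d k) (Gtrunc (e ℕ.+ d) k)
Gtrunc-stable zero d k _ _ = refl
Gtrunc-stable (suc e) d k i i≤ =
  trans (Gtrunc-stable e d k i i≤) (Gtrunc-step (e ℕ.+ d) k i (ℕP.≤-trans i≤ (ℕP.m≤n+m d e)))

G : ℕ → Series
G k n = Gtrunc (suc n) k n

G-approx : ∀ d k → Agree d (G k) (Gtrunc (suc d) k)
G-approx d k i i≤ = trans (Gtrunc-stable (d ∸ i) (suc i) k i (ℕP.n≤1+n i)) (cong (λ t → Gtrunc t k i) depth)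
  where
  depth : (d ∸ i) ℕ.+ suc i ≡ suc d
  depth = trans (ℕP.+-suc (d ∸ i) i) (cong suc (ℕP.m∸n+n≡m i≤))

G-at-0 : ∀ k → G k 0 ≡ 1ℚ
G-at-0 k = ⊘-at-0 {1S} {Δ (n̂ k) xS 1S} refl (Δ-at-0 (n̂ k) 1S)

G-relation : ∀ k → G k ⊛ Δ (n̂ k) xS (G (suc k)) ≈ 1S
G-relation k n = begin
  (G k ⊛ Δ (n̂ k) xS (G (suc k))) n
    ≡⟨ ⊛-local n (Agree-pred (G-approx (suc n) k)) (Agree-pred (Δ-Agree n (n̂ k) (G-approx n (suc k)))) ⟩
  (Gtrunc (suc (suc n)) k ⊛ Δ') n
    ≡⟨ ⊛-comm (Gtrunc (suc (suc n)) k) Δ' n ⟩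
  (Δ' ⊛ (1S ⊘ Δ')) n
    ≡⟨ ⊘-spec 1S Δ' (Δ≢0 (n̂ k) (Gtrunc (suc n) (suc k))) n ⟩
  1S n ∎
  where
  open ≡-Reasoning
  Δ' = Δ (n̂ k) xS (Gtrunc (suc n) (suc k))

-- Generating series of the weighted Motzkin paths from height k down to 0:
-- first return to height k, then a down step, then paths from height k-1.

Q : ℕ → Series
Q zero = 1S
Q (suc k) = G (suc k) ⊛ (n̂ (suc k) ⊛ (xS ⊛ Q k))

Q-step : ∀ k → Q (suc k) ≈ xS ⊛ (n̂ (suc k) ⊛ (Q k ⊕ Q (suc k) ⊕ κ ½ ⊛ Q (suc (suc k))))
Q-step k = begin
  Q1  ≈⟨ modulo₁ (A ⊛ (xS ⊛ Q k)) (G-relation (suc k))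
           (solve 5 (λ X a g1 g2 q →
               g1 :* (a :* (X :* q))
               := X :* (a :* (q :+ g1 :* (a :* (X :* q)) :+ con ½ :* (g2 :* ((con 1ℚ :+ a) :* (X :* (g1 :* (a :* (X :* q))))))))
                  :+ (g1 :* (con 1ℚ :- (a :* X :+ con ½ :* a :* (a :+ con 1ℚ) :* (X :* (X :* g2)))) :- con 1ℚ) :* (a :* (X :* q)))
              ≈-refl xS A (G (suc k)) (G (suc (suc k))) (Q k)) ⟩
  xS ⊛ (A ⊛ (Q k ⊕ Q1 ⊕ κ ½ ⊛ (G (suc (suc k)) ⊛ ((1S ⊕ A) ⊛ (xS ⊛ Q1)))))
      ≈⟨ ⊛-congʳ xS (⊛-congʳ A (⊕-congʳ (Q k ⊕ Q1) (⊛-congʳ (κ ½)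
           (⊛-congʳ (G (suc (suc k))) (⊛-congˡ (xS ⊛ Q1) (≈-sym (n̂-suc (suc k)))))))) ⟩
  xS ⊛ (A ⊛ (Q k ⊕ Q1 ⊕ κ ½ ⊛ Q (suc (suc k)))) ∎
  where
  open ≈-Reasoning; open S-Solver
  A = n̂ (suc k)
  Q1 = Q (suc k)

Q-table : MotzkinTable (λ k n → Q k n)
Q-table = record
  { origin = refl
  ; start-high = λ k → trans (cong (G (suc k) 0 *_) (x-multiple0 (n̂ (suc k)) (Q k))) (*-zeroʳ (G (suc k) 0))
  ; stay-low = λ n → refl
  ; step = λ k n → trans (Q-step k (suc n))
      (trans (x-coeffS (n̂ (suc k) ⊛ (Q k ⊕ Q (suc k) ⊕ κ ½ ⊛ Q (suc (suc k)))) n)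
             (coeff-step (ℕtoℚ (suc k)) (Q k) (Q (suc k)) (Q (suc (suc k))) n)) }

E-series : ∀ n → E n ≡ (1S ⊕ xS ⊛ G 1) n
E-series n = begin
  E n                  ≡⟨ E≡V0+V1 n ⟩
  V 0 n + V 1 n        ≡⟨ cong₂ _+_ (MotzkinTable-unique V-table Q-table n 0) (MotzkinTable-unique V-table Q-table n 1) ⟩
  Q 0 n + Q 1 n        ≡⟨ cong (Q 0 n +_) (Q1≈xG1 n) ⟩
  (1S ⊕ xS ⊛ G 1) n    ∎
  where
  open ≡-Reasoning
  Q1≈xG1 : Q 1 ≈ xS ⊛ G 1
  Q1≈xG1 = solve 2 (λ g X → g :* (con 1ℚ :* (X :* con 1ℚ)) := X :* g) ≈-refl (G 1) xS
    where open S-Solver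

-- For j = 3m + r the tail of the continued fraction at
-- index j+1 is a quotient of G_{4m}, …, G_{4m+5}; the numerators,
-- denominators and the partial numerators/denominators a_j, b_j are
-- polynomials in m, x and the G's.

module ContractionExpressions {A : Set} (add mul : A → A → A) (neg : A → A) (const : ℚ → A) where
  private
    module R = RingExpressions add mul neg const
    infixl 6 _+ᴿ_ _−ᴿ_
    infixl 7 _*ᴿ_
    _+ᴿ_ _*ᴿ_ _−ᴿ_ : A → A → A
    p +ᴿ q = add p q
    p *ᴿ q = mul p q
    p −ᴿ q = add p (neg q)
    1ᴿ : A
    1ᴿ = const 1ℚ

  -- T_{3m+1} = N₁/D₁,  T_{3m+2} = N₂/G_{4m+2},  T_{3m+3} = 1/D₃ where D₃ = G_{4m+3} N₁(m+1)
  N₁ : (m x g₀ : A) → A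
  N₁ m x g₀ = 1ᴿ +ᴿ R.n̂ 2 *ᴿ m *ᴿ (x *ᴿ g₀)

  D₁ : (m x g₀ g₁ : A) → A
  D₁ m x g₀ g₁ = g₀ *ᴿ (1ᴿ +ᴿ R.lin 4 1 m *ᴿ (x *ᴿ g₁))

  N₂ : (m x g₂ : A) → A
  N₂ m x g₂ = 1ᴿ −ᴿ R.lin 4 1 m *ᴿ R.lin 2 1 m *ᴿ (x *ᴿ (x *ᴿ g₂))

  D₃ : (m x g₃ g₄ : A) → A
  D₃ m x g₃ g₄ = g₃ *ᴿ N₁ (R.lin 1 1 m) x g₄

  -- b_{3m+1}, a_{3m+2}, b_{3m+2}, a_{3m+3}, b_{3m+3}, a_{3m+4}
  b₁ a₂ b₂ a₃ b₃ a₄ : (m x : A) → A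
  b₁ m x = 1ᴿ +ᴿ neg (R.lin 6 1 m) *ᴿ R.pow x 1
  a₂ m x = neg (R.lin 4 1 m *ᴿ R.lin 4 1 m *ᴿ R.lin 2 1 m) *ᴿ R.pow x 3
  b₂ m x = 1ᴿ +ᴿ neg (R.lin 4 2 m) *ᴿ R.pow x 1 +ᴿ neg (R.n̂ 4 *ᴿ (R.lin 2 1 m *ᴿ R.lin 2 1 m)) *ᴿ R.pow x 2
  a₃ m x = neg (R.lin 4 3 m *ᴿ R.lin 4 3 m *ᴿ R.lin 2 1 m) *ᴿ R.pow x 3
  b₃ m x = 1ᴿ +ᴿ neg (R.lin 6 5 m) *ᴿ R.pow x 1
  a₄ m x = neg (R.n̂ 4 *ᴿ (R.lin 1 1 m *ᴿ R.lin 1 1 m)) *ᴿ R.pow x 2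

  excess : ℕ → (m x g g' : A) → A
  excess r m x g g' = g *ᴿ R.Δ (R.lin 4 r m) x g' −ᴿ 1ᴿ

open ContractionExpressions _⊕_ _⊛_ negS κ

module P {n : ℕ} where
  open RingExpressions {S-Solver.Polynomial n} S-Solver._:+_ S-Solver._:*_ S-Solver.:-_ S-Solver.con public
  open ContractionExpressions {S-Solver.Polynomial n} S-Solver._:+_ S-Solver._:*_ S-Solver.:-_ S-Solver.con public

-- The three steps T_j = b_j + a_{j+1}/T_{j+1} as polynomial identities
-- N N' = D (b N' + a D') modulo the relations at two consecutive levels.

contraction₁ : ∀ m x g₀ g₁ g₂ → g₀ ⊛ Δ (lin 4 0 m) x g₁ ≈ 1S → g₁ ⊛ Δ (lin 4 1 m) x g₂ ≈ 1S →
  N₁ m x g₀ ⊛ N₂ m x g₂ ≈ D₁ m x g₀ g₁ ⊛ (b₁ m x ⊛ N₂ m x g₂ ⊕ a₂ m x ⊛ g₂)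
contraction₁ m x g₀ g₁ g₂ h₀ h₁ = modulo₂ u v h₀ h₁
  (solve 5 (λ m x g₀ g₁ g₂ →
      P.N₁ m x g₀ :* P.N₂ m x g₂
      := P.D₁ m x g₀ g₁ :* (P.b₁ m x :* P.N₂ m x g₂ :+ P.a₂ m x :* g₂)
         :+ (P.excess 0 m x g₀ g₁ :* (P.lin 4 1 m :* P.lin 2 1 m :* (x :* (x :* g₂)) :- con 1ℚ)
             :+ P.excess 1 m x g₁ g₂ :* (g₀ :* (:- (P.lin 4 1 m :* x))))) ≈-refl m x g₀ g₁ g₂)
  where
  open S-Solver
  u = lin 4 1 m ⊛ lin 2 1 m ⊛ (x ⊛ (x ⊛ g₂)) ⊕ negS 1S
  v = g₀ ⊛ negS (lin 4 1 m ⊛ x)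

contraction₂ : ∀ m x g₂ g₃ g₄ → g₂ ⊛ Δ (lin 4 2 m) x g₃ ≈ 1S → g₃ ⊛ Δ (lin 4 3 m) x g₄ ≈ 1S →
  N₂ m x g₂ ⊛ 1S ≈ g₂ ⊛ (b₂ m x ⊛ 1S ⊕ a₃ m x ⊛ D₃ m x g₃ g₄)
contraction₂ m x g₂ g₃ g₄ h₂ h₃ = modulo₂ (negS 1S) v h₂ h₃
  (solve 5 (λ m x g₂ g₃ g₄ →
      P.N₂ m x g₂ :* con 1ℚ
      := g₂ :* (P.b₂ m x :* con 1ℚ :+ P.a₃ m x :* P.D₃ m x g₃ g₄)
         :+ (P.excess 2 m x g₂ g₃ :* (:- con 1ℚ)
             :+ P.excess 3 m x g₃ g₄ :* (g₂ :* (:- (P.lin 4 3 m :* P.lin 2 1 m :* (x :* x)))))) ≈-refl m x g₂ g₃ g₄)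
  where
  open S-Solver
  v = g₂ ⊛ negS (lin 4 3 m ⊛ lin 2 1 m ⊛ (x ⊛ x))

contraction₃ : ∀ m x g₃ g₄ g₅ → g₃ ⊛ Δ (lin 4 3 m) x g₄ ≈ 1S → g₄ ⊛ Δ (lin 4 4 m) x g₅ ≈ 1S →
  1S ⊛ N₁ (lin 1 1 m) x g₄ ≈ D₃ m x g₃ g₄ ⊛ (b₃ m x ⊛ N₁ (lin 1 1 m) x g₄ ⊕ a₄ m x ⊛ D₁ (lin 1 1 m) x g₄ g₅)
contraction₃ m x g₃ g₄ g₅ h₃ h₄ = modulo₂ (negS (N₁ (lin 1 1 m) x g₄)) v h₃ h₄
  (solve 5 (λ m x g₃ g₄ g₅ →
      con 1ℚ :* P.N₁ (P.lin 1 1 m) x g₄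
      := P.D₃ m x g₃ g₄ :* (P.b₃ m x :* P.N₁ (P.lin 1 1 m) x g₄ :+ P.a₄ m x :* P.D₁ (P.lin 1 1 m) x g₄ g₅)
         :+ (P.excess 3 m x g₃ g₄ :* (:- P.N₁ (P.lin 1 1 m) x g₄)
             :+ P.excess 4 m x g₄ g₅
                  :* (g₃ :* (:- (P.n̂ 2 :* P.lin 1 1 m :* x :+ P.n̂ 4 :* (P.lin 1 1 m :* P.lin 1 1 m) :* (x :* (x :* g₄))))))) ≈-refl m x g₃ g₄ g₅)
  where
  open S-Solver
  v = g₃ ⊛ negS (n̂ 2 ⊛ lin 1 1 m ⊛ x ⊕ n̂ 4 ⊛ (lin 1 1 m ⊛ lin 1 1 m) ⊛ (x ⊛ (x ⊛ g₄)))

index₃ : ∀ r m → r < 3 → (r ℕ.+ m ℕ.* 3) / 3 ≡ m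
index₃ r m r<3 = begin
  (r ℕ.+ m ℕ.* 3) / 3      ≡⟨ ℕDM.+-distrib-/-∣ʳ r (n∣m*n m) ⟩
  r / 3 ℕ.+ m ℕ.* 3 / 3    ≡⟨ cong₂ ℕ._+_ (ℕDM.m<n⇒m/n≡0 r<3) (ℕDM.m*n/n≡m m 3) ⟩
  m                        ∎
  where open ≡-Reasoning

residue₃ : ∀ r m → r < 3 → (r ℕ.+ m ℕ.* 3) % 3 ≡ r
residue₃ r m r<3 = trans (ℕDM.[m+kn]%n≡m%n r m 3) (ℕDM.m<n⇒m%n≡m r<3)

a-at : ∀ r m → r < 3 → a (r ℕ.+ m ℕ.* 3) ≡ a' m r
a-at r m r<3 = cong₂ a' (index₃ r m r<3) (residue₃ r m r<3)

b-at : ∀ r m → r < 3 → b (r ℕ.+ m ℕ.* 3) ≡ b' m r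
b-at r m r<3 = cong₂ b' (index₃ r m r<3) (residue₃ r m r<3)

0<3 : 0 < 3
0<3 = s≤s z≤n
1<3 : 1 < 3
1<3 = s≤s (s≤s z≤n)
2<3 : 2 < 3
2<3 = s≤s (s≤s (s≤s z≤n))

pow-x : ∀ d n → pow xS d n ≡ mono 1ℚ d n
pow-x zero n = refl
pow-x (suc d) zero = x-coeff0 (pow xS d)
pow-x (suc d) (suc n) = trans (x-coeffS (pow xS d) n) (pow-x d n)

negated-monomial : ∀ N d {e} → n̂ N ≈ e → mono (- ℕtoℚ N) d ≈ negS e ⊛ pow xS d
negated-monomial N d {e} N≈e n = begin
  mono (- ℕtoℚ N) d n             ≡⟨ times-indicator (n ℕ.≡ᵇ d) ⟩
  - ℕtoℚ N * mono 1ℚ d n          ≡⟨ cong (- ℕtoℚ N *_) (sym (pow-x d n)) ⟩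
  - ℕtoℚ N * pow xS d n           ≡⟨ sym (κ-coeff (- ℕtoℚ N) (pow xS d) n) ⟩
  (κ (- ℕtoℚ N) ⊛ pow xS d) n     ≡⟨ ⊛-congˡ (pow xS d) (≈-trans (κ-neg (ℕtoℚ N)) (negS-cong N≈e)) n ⟩
  (negS e ⊛ pow xS d) n           ∎
  where
  open ≡-Reasoning
  times-indicator : ∀ t → (if t then - ℕtoℚ N else 0ℚ) ≡ - ℕtoℚ N * (if t then 1ℚ else 0ℚ)
  times-indicator true = sym (*-identityʳ (- ℕtoℚ N))
  times-indicator false = sym (*-zeroʳ (- ℕtoℚ N))

n̂-lin : ∀ {N} p q m → N ≡ p ℕ.* m ℕ.+ q → n̂ N ≈ lin p q (n̂ m)
n̂-lin p q m refl = ≈-trans (n̂-+ (p ℕ.* m) q) (⊕-cong (n̂-* p m) ≈-refl)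

n̂-square : ∀ X → n̂ (X ℕ.^ 2) ≈ n̂ X ⊛ n̂ X
n̂-square X = ≈-trans (κ-cong (cong ℕtoℚ (cong (X ℕ.*_) (ℕP.*-identityʳ X)))) (n̂-* X X)

suc-times-suc∸1 : ∀ p m → suc p ℕ.* suc m ∸ 1 ≡ suc p ℕ.* m ℕ.+ p
suc-times-suc∸1 p m = trans (cong (_∸ 1) (ℕP.*-suc (suc p) m)) (ℕP.+-comm p (suc p ℕ.* m))

twice-odd : ∀ m → 2 ℕ.* (2 ℕ.* m ℕ.+ 1) ≡ 4 ℕ.* m ℕ.+ 2
twice-odd = solve-∀

suc≡1*m+1 : ∀ m → suc m ≡ 1 ℕ.* m ℕ.+ 1
suc≡1*m+1 = solve-∀

b₁-form : ∀ m → b (1 ℕ.+ m ℕ.* 3) ≈ b₁ (n̂ m) xS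
b₁-form m = ≈-trans (≡⇒≈ (trans (b-at 1 m 1<3) (shape m)))
  (⊕-congʳ 1S (negated-monomial (6 ℕ.* m ℕ.+ 1) 1 (n̂-lin 6 1 m refl)))
  where
  shape : ∀ m → b' m 1 ≡ mono 1ℚ 0 ⊕ mono (- ℕtoℚ (6 ℕ.* m ℕ.+ 1)) 1
  shape zero = refl
  shape (suc m) = refl

a₂-form : ∀ m → a (2 ℕ.+ m ℕ.* 3) ≈ a₂ (n̂ m) xS
a₂-form m = ≈-trans (≡⇒≈ (trans (a-at 2 m 2<3) (shape m)))
  (negated-monomial ((4 ℕ.* m ℕ.+ 1) ℕ.^ 2 ℕ.* (2 ℕ.* m ℕ.+ 1)) 3 (≈-trans (n̂-* ((4 ℕ.* m ℕ.+ 1) ℕ.^ 2) (2 ℕ.* m ℕ.+ 1))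
                          (⊛-cong (≈-trans (n̂-square (4 ℕ.* m ℕ.+ 1)) (⊛-cong (n̂-lin 4 1 m refl) (n̂-lin 4 1 m refl)))
                                  (n̂-lin 2 1 m refl))))
  where
  shape : ∀ m → a' m 2 ≡ mono (- ℕtoℚ ((4 ℕ.* m ℕ.+ 1) ℕ.^ 2 ℕ.* (2 ℕ.* m ℕ.+ 1))) 3
  shape zero = refl
  shape (suc m) = refl

b₂-form : ∀ m → b (2 ℕ.+ m ℕ.* 3) ≈ b₂ (n̂ m) xS
b₂-form m = ≈-trans (≡⇒≈ (trans (b-at 2 m 2<3) (shape m)))
  (⊕-cong (⊕-congʳ 1S (negated-monomial (2 ℕ.* (2 ℕ.* m ℕ.+ 1)) 1 (n̂-lin 4 2 m (twice-odd m))))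
          (negated-monomial (4 ℕ.* (2 ℕ.* m ℕ.+ 1) ℕ.^ 2) 2 (≈-trans (n̂-* 4 ((2 ℕ.* m ℕ.+ 1) ℕ.^ 2))
             (⊛-congʳ (n̂ 4) (≈-trans (n̂-square (2 ℕ.* m ℕ.+ 1)) (⊛-cong (n̂-lin 2 1 m refl) (n̂-lin 2 1 m refl)))))))
  where
  shape : ∀ m → b' m 2 ≡ mono 1ℚ 0 ⊕ mono (- ℕtoℚ (2 ℕ.* (2 ℕ.* m ℕ.+ 1))) 1
                           ⊕ mono (- ℕtoℚ (4 ℕ.* (2 ℕ.* m ℕ.+ 1) ℕ.^ 2)) 2
  shape zero = refl
  shape (suc m) = refl

a₃-form : ∀ m → a (3 ℕ.+ m ℕ.* 3) ≈ a₃ (n̂ m) xS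
a₃-form m = ≈-trans (≡⇒≈ (a-at 0 (suc m) 0<3))
  (negated-monomial ((4 ℕ.* suc m ∸ 1) ℕ.^ 2 ℕ.* (2 ℕ.* suc m ∸ 1)) 3 (≈-trans (n̂-* ((4 ℕ.* suc m ∸ 1) ℕ.^ 2) (2 ℕ.* suc m ∸ 1))
     (⊛-cong (≈-trans (n̂-square (4 ℕ.* suc m ∸ 1)) (⊛-cong (n̂-lin 4 3 m (suc-times-suc∸1 3 m)) (n̂-lin 4 3 m (suc-times-suc∸1 3 m))))
             (n̂-lin 2 1 m (suc-times-suc∸1 1 m)))))

b₃-form : ∀ m → b (3 ℕ.+ m ℕ.* 3) ≈ b₃ (n̂ m) xS
b₃-form m = ≈-trans (≡⇒≈ (b-at 0 (suc m) 0<3))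
  (⊕-congʳ 1S (negated-monomial (6 ℕ.* suc m ∸ 1) 1 (n̂-lin 6 5 m (suc-times-suc∸1 5 m))))

a₄-form : ∀ m → a (4 ℕ.+ m ℕ.* 3) ≈ a₄ (n̂ m) xS
a₄-form m = ≈-trans (≡⇒≈ (a-at 1 (suc m) 1<3))
  (negated-monomial (4 ℕ.* suc m ℕ.^ 2) 2 (≈-trans (n̂-* 4 (suc m ℕ.^ 2))
     (⊛-congʳ (n̂ 4) (≈-trans (n̂-square (suc m)) (⊛-cong (n̂-lin 1 1 m (suc≡1*m+1 m)) (n̂-lin 1 1 m (suc≡1*m+1 m)))))))

level-index : ∀ r m → r ℕ.+ m ℕ.* 4 ≡ 4 ℕ.* m ℕ.+ r
level-index = solve-∀

level-relation : ∀ r m → G (r ℕ.+ m ℕ.* 4) ⊛ Δ (lin 4 r (n̂ m)) xS (G (suc r ℕ.+ m ℕ.* 4)) ≈ 1S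
level-relation r m = ≈-trans (⊛-congʳ (G k) (Δ-cong (≈-sym (n̂-lin 4 r m (level-index r m)))))
                             (G-relation k)
  where
  k = r ℕ.+ m ℕ.* 4
  Δ-cong : ∀ {c c' g} → c ≈ c' → Δ c xS g ≈ Δ c' xS g
  Δ-cong p = ⊕-congʳ 1S (negS-cong (⊕-cong (⊛-congˡ xS p) (⊛-congˡ _ (⊛-cong (⊛-congʳ (κ ½) p) (⊕-cong p ≈-refl)))))

N₁-cong : ∀ {m m'} g → m ≈ m' → N₁ m xS g ≈ N₁ m' xS g
N₁-cong g p = ⊕-congʳ 1S (⊛-congˡ (xS ⊛ g) (⊛-congʳ (n̂ 2) p))

D₁-cong : ∀ {m m'} g g' → m ≈ m' → D₁ m xS g g' ≈ D₁ m' xS g g'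
D₁-cong g g' p = ⊛-congʳ g (⊕-congʳ 1S (⊛-congˡ (xS ⊛ g') (⊕-cong (⊛-congʳ (n̂ 4) p) ≈-refl)))

1+x-multiple-at-0 : ∀ c g → (1S ⊕ c ⊛ (xS ⊛ g)) 0 ≡ 1ℚ
1+x-multiple-at-0 c g = trans (cong (1ℚ +_) (x-multiple0 c g)) (+-identityʳ 1ℚ)

N₁-at-0 : ∀ m g → N₁ m xS g 0 ≡ 1ℚ
N₁-at-0 m g = 1+x-multiple-at-0 (n̂ 2 ⊛ m) g

D₁-at-0 : ∀ m g g' → g 0 ≡ 1ℚ → D₁ m xS g g' 0 ≡ 1ℚ
D₁-at-0 m g g' g0 = trans (cong₂ _*_ g0 (1+x-multiple-at-0 (lin 4 1 m) g')) (*-identityˡ 1ℚ)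

N₂-at-0 : ∀ m g → N₂ m xS g 0 ≡ 1ℚ
N₂-at-0 m g = trans (cong (λ u → 1ℚ + - u) (x-multiple0 (lin 4 1 m ⊛ lin 2 1 m) (xS ⊛ g))) (+-identityʳ 1ℚ)

D₃-at-0 : ∀ m g g' → g 0 ≡ 1ℚ → D₃ m xS g g' 0 ≡ 1ℚ
D₃-at-0 m g g' g0 = trans (cong₂ _*_ g0 (N₁-at-0 (lin 1 1 m) g')) (*-identityˡ 1ℚ)

-- tail-parts m r = T_{3m+r+1};  tail j = T_{j+1}
tail-parts : ℕ → ℕ → Series
tail-parts m zero = N₁ (n̂ m) xS (G (m ℕ.* 4)) ⊘ D₁ (n̂ m) xS (G (m ℕ.* 4)) (G (1 ℕ.+ m ℕ.* 4))
tail-parts m (suc zero) = N₂ (n̂ m) xS (G (2 ℕ.+ m ℕ.* 4)) ⊘ G (2 ℕ.+ m ℕ.* 4)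
tail-parts m (suc (suc _)) = 1S ⊘ D₃ (n̂ m) xS (G (3 ℕ.+ m ℕ.* 4)) (G (4 ℕ.+ m ℕ.* 4))

tail : ℕ → Series
tail j = tail-parts (j / 3) (j % 3)

tail-at : ∀ r m → r < 3 → tail (r ℕ.+ m ℕ.* 3) ≡ tail-parts m r
tail-at r m r<3 = cong₂ tail-parts (index₃ r m r<3) (residue₃ r m r<3)

tail-parts-at-0 : ∀ m r → tail-parts m r 0 ≡ 1ℚ
tail-parts-at-0 m zero =
  ⊘-at-0 {N₁ (n̂ m) xS g₀} {D₁ (n̂ m) xS g₀ g₁} (N₁-at-0 (n̂ m) g₀) (D₁-at-0 (n̂ m) g₀ g₁ (G-at-0 (m ℕ.* 4)))
  where g₀ = G (m ℕ.* 4); g₁ = G (1 ℕ.+ m ℕ.* 4)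
tail-parts-at-0 m (suc zero) = ⊘-at-0 {N₂ (n̂ m) xS g₂} {g₂} (N₂-at-0 (n̂ m) g₂) (G-at-0 (2 ℕ.+ m ℕ.* 4))
  where g₂ = G (2 ℕ.+ m ℕ.* 4)
tail-parts-at-0 m (suc (suc _)) = ⊘-at-0 {1S} {D₃ (n̂ m) xS g₃ g₄} refl (D₃-at-0 (n̂ m) g₃ g₄ (G-at-0 (3 ℕ.+ m ℕ.* 4)))
  where g₃ = G (3 ℕ.+ m ℕ.* 4); g₄ = G (4 ℕ.+ m ℕ.* 4)

tail-at-0 : ∀ j → tail j 0 ≡ 1ℚ
tail-at-0 j = tail-parts-at-0 (j / 3) (j % 3)

tail≢0 : ∀ j → tail j 0 ≢ 0ℚ
tail≢0 j = ≡1⇒≢0 (tail-at-0 j)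

tail-step₁ : ∀ m → tail (m ℕ.* 3) ≈ b (1 ℕ.+ m ℕ.* 3) ⊕ a (2 ℕ.+ m ℕ.* 3) ⊘ tail (1 ℕ.+ m ℕ.* 3)
tail-step₁ m = begin
  tail (m ℕ.* 3)                              ≡⟨ tail-at 0 m 0<3 ⟩
  N₁ μ xS g₀ ⊘ D₁ μ xS g₀ g₁
    ≈⟨ continued-fraction-step (≡1⇒≢0 (D₁-at-0 μ g₀ g₁ (G-at-0 (m ℕ.* 4))))
         (≡1⇒≢0 (N₂-at-0 μ g₂)) (≡1⇒≢0 (G-at-0 (2 ℕ.+ m ℕ.* 4)))
         (contraction₁ μ xS g₀ g₁ g₂ (level-relation 0 m) (level-relation 1 m)) ⟩
  b₁ μ xS ⊕ a₂ μ xS ⊘ (N₂ μ xS g₂ ⊘ g₂)       ≡⟨ cong (λ t → b₁ μ xS ⊕ a₂ μ xS ⊘ t) (sym (tail-at 1 m 1<3)) ⟩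
  b₁ μ xS ⊕ a₂ μ xS ⊘ tail (1 ℕ.+ m ℕ.* 3)
    ≈⟨ ⊕-cong (≈-sym (b₁-form m)) (⊘-congˡ (tail≢0 (1 ℕ.+ m ℕ.* 3)) (≈-sym (a₂-form m))) ⟩
  b (1 ℕ.+ m ℕ.* 3) ⊕ a (2 ℕ.+ m ℕ.* 3) ⊘ tail (1 ℕ.+ m ℕ.* 3) ∎
  where
  open ≈-Reasoning
  μ = n̂ m
  g₀ = G (m ℕ.* 4); g₁ = G (1 ℕ.+ m ℕ.* 4); g₂ = G (2 ℕ.+ m ℕ.* 4)

tail-step₂ : ∀ m → tail (1 ℕ.+ m ℕ.* 3) ≈ b (2 ℕ.+ m ℕ.* 3) ⊕ a (3 ℕ.+ m ℕ.* 3) ⊘ tail (2 ℕ.+ m ℕ.* 3)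
tail-step₂ m = begin
  tail (1 ℕ.+ m ℕ.* 3)                        ≡⟨ tail-at 1 m 1<3 ⟩
  N₂ μ xS g₂ ⊘ g₂
    ≈⟨ continued-fraction-step (≡1⇒≢0 (G-at-0 (2 ℕ.+ m ℕ.* 4)))
         (≡1⇒≢0 refl) (≡1⇒≢0 (D₃-at-0 μ g₃ g₄ (G-at-0 (3 ℕ.+ m ℕ.* 4))))
         (contraction₂ μ xS g₂ g₃ g₄ (level-relation 2 m) (level-relation 3 m)) ⟩
  b₂ μ xS ⊕ a₃ μ xS ⊘ (1S ⊘ D₃ μ xS g₃ g₄)   ≡⟨ cong (λ t → b₂ μ xS ⊕ a₃ μ xS ⊘ t) (sym (tail-at 2 m 2<3)) ⟩
  b₂ μ xS ⊕ a₃ μ xS ⊘ tail (2 ℕ.+ m ℕ.* 3)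
    ≈⟨ ⊕-cong (≈-sym (b₂-form m)) (⊘-congˡ (tail≢0 (2 ℕ.+ m ℕ.* 3)) (≈-sym (a₃-form m))) ⟩
  b (2 ℕ.+ m ℕ.* 3) ⊕ a (3 ℕ.+ m ℕ.* 3) ⊘ tail (2 ℕ.+ m ℕ.* 3) ∎
  where
  open ≈-Reasoning
  μ = n̂ m
  g₂ = G (2 ℕ.+ m ℕ.* 4); g₃ = G (3 ℕ.+ m ℕ.* 4); g₄ = G (4 ℕ.+ m ℕ.* 4)

tail-step₃ : ∀ m → tail (2 ℕ.+ m ℕ.* 3) ≈ b (3 ℕ.+ m ℕ.* 3) ⊕ a (4 ℕ.+ m ℕ.* 3) ⊘ tail (3 ℕ.+ m ℕ.* 3)
tail-step₃ m = begin
  tail (2 ℕ.+ m ℕ.* 3)                        ≡⟨ tail-at 2 m 2<3 ⟩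
  1S ⊘ D₃ μ xS g₃ g₄
    ≈⟨ continued-fraction-step (≡1⇒≢0 (D₃-at-0 μ g₃ g₄ (G-at-0 (3 ℕ.+ m ℕ.* 4))))
         (≡1⇒≢0 (N₁-at-0 μ' g₄)) (≡1⇒≢0 D₁'-at-0)
         (contraction₃ μ xS g₃ g₄ g₅ (level-relation 3 m) (level-relation 4 m)) ⟩
  b₃ μ xS ⊕ a₄ μ xS ⊘ (N₁ μ' xS g₄ ⊘ D₁ μ' xS g₄ g₅)
    ≈⟨ ⊕-cong (≈-sym (b₃-form m))
         (⊘-cong quotient≢0 (≡1⇒≢0 (tail-parts-at-0 (suc m) 0)) (≈-sym (a₄-form m)) next-period) ⟩
  b (3 ℕ.+ m ℕ.* 3) ⊕ a (4 ℕ.+ m ℕ.* 3) ⊘ tail-parts (suc m) 0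
    ≡⟨ cong (λ t → b (3 ℕ.+ m ℕ.* 3) ⊕ a (4 ℕ.+ m ℕ.* 3) ⊘ t) (sym (tail-at 0 (suc m) 0<3)) ⟩
  b (3 ℕ.+ m ℕ.* 3) ⊕ a (4 ℕ.+ m ℕ.* 3) ⊘ tail (3 ℕ.+ m ℕ.* 3) ∎
  where
  open ≈-Reasoning
  μ = n̂ m
  μ' = lin 1 1 μ
  g₃ = G (3 ℕ.+ m ℕ.* 4); g₄ = G (4 ℕ.+ m ℕ.* 4); g₅ = G (5 ℕ.+ m ℕ.* 4)
  D₁'-at-0 : D₁ μ' xS g₄ g₅ 0 ≡ 1ℚ
  D₁'-at-0 = D₁-at-0 μ' g₄ g₅ (G-at-0 (4 ℕ.+ m ℕ.* 4))
  quotient≢0 : (N₁ μ' xS g₄ ⊘ D₁ μ' xS g₄ g₅) 0 ≢ 0ℚ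
  quotient≢0 = ≡1⇒≢0 (⊘-at-0 {N₁ μ' xS g₄} {D₁ μ' xS g₄ g₅} (N₁-at-0 μ' g₄) D₁'-at-0)
  -- with m + 1 written as the expression 1·m + 1, the quotient is T_{3(m+1)+1}
  next-period : N₁ μ' xS g₄ ⊘ D₁ μ' xS g₄ g₅ ≈ tail-parts (suc m) 0
  next-period = ⊘-cong (≡1⇒≢0 D₁'-at-0) (≡1⇒≢0 (D₁-at-0 (n̂ (suc m)) g₄ g₅ (G-at-0 (4 ℕ.+ m ℕ.* 4))))
                       (N₁-cong g₄ m+1≈) (D₁-cong g₄ g₅ m+1≈)
    where
    m+1≈ : μ' ≈ n̂ (suc m)
    m+1≈ = ≈-sym (n̂-lin 1 1 m (suc≡1*m+1 m))

by-residue₃ : (Pr : ℕ → Set) →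
  (∀ m → Pr (m ℕ.* 3)) → (∀ m → Pr (1 ℕ.+ m ℕ.* 3)) → (∀ m → Pr (2 ℕ.+ m ℕ.* 3)) → ∀ j → Pr j
by-residue₃ Pr p₀ p₁ p₂ j = subst Pr (sym (ℕDM.m≡m%n+[m/n]*n j 3)) (by-cases (j % 3) (ℕDM.m%n<n j 3) (j / 3))
  where
  by-cases : ∀ r → r < 3 → ∀ m → Pr (r ℕ.+ m ℕ.* 3)
  by-cases zero _ = p₀
  by-cases (suc zero) _ = p₁
  by-cases (suc (suc zero)) _ = p₂
  by-cases (suc (suc (suc r))) (s≤s (s≤s (s≤s ())))

tail-step : ∀ j → tail j ≈ b (suc j) ⊕ a (suc (suc j)) ⊘ tail (suc j)
tail-step = by-residue₃ (λ j → tail j ≈ b (suc j) ⊕ a (suc (suc j)) ⊘ tail (suc j)) tail-step₁ tail-step₂ tail-step₃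

a-at-0 : ∀ j → a (suc (suc j)) 0 ≡ 0ℚ
a-at-0 = by-residue₃ (λ j → a (suc (suc j)) 0 ≡ 0ℚ)
  (λ m → trans (a₂-form m 0) (x-multiple0 (negS (lin 4 1 (n̂ m) ⊛ lin 4 1 (n̂ m) ⊛ lin 2 1 (n̂ m))) (pow xS 2)))
  (λ m → trans (a₃-form m 0) (x-multiple0 (negS (lin 4 3 (n̂ m) ⊛ lin 4 3 (n̂ m) ⊛ lin 2 1 (n̂ m))) (pow xS 2)))
  (λ m → trans (a₄-form m 0) (x-multiple0 (negS (n̂ 4 ⊛ (lin 1 1 (n̂ m) ⊛ lin 1 1 (n̂ m)))) (pow xS 1)))

tail-agree : ∀ r j → Agree r (tailCF (suc j) r) (tail j)
tail-agree zero j zero z≤n = sym (begin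
  tail j 0                                              ≡⟨ tail-step j 0 ⟩
  b (suc j) 0 + a (suc (suc j)) 0 * invQ (tail (suc j) 0)  ≡⟨ cong (λ u → b (suc j) 0 + u * invQ (tail (suc j) 0)) (a-at-0 j) ⟩
  b (suc j) 0 + 0ℚ * invQ (tail (suc j) 0)              ≡⟨ cong (b (suc j) 0 +_) (*-zeroˡ (invQ (tail (suc j) 0))) ⟩
  b (suc j) 0 + 0ℚ                                      ≡⟨ +-identityʳ _ ⟩
  b (suc j) 0                                           ∎)
  where open ≡-Reasoning
tail-agree (suc r) j i i≤ =
  trans (cong (b (suc j) i +_) (⊘-local-shift r (a-at-0 j) convergent≢0 (tail≢0 (suc j)) deeper i i≤))
        (sym (tail-step j i))
  where
  deeper = tail-agree r (suc j)
  convergent≢0 : tailCF (suc (suc j)) r 0 ≢ 0ℚ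
  convergent≢0 = ≡1⇒≢0 (trans (deeper 0 z≤n) (tail-at-0 (suc j)))

E-as-quotient : 1S ⊕ xS ⊛ G 1 ≈ 1S ⊘ tail 0
E-as-quotient = ⊘-unique (tail≢0 0) (begin
  tail 0 ⊛ (1S ⊕ xS ⊛ G 1)          ≈⟨ ⊛-congʳ (tail 0) (≈-sym D≈1+xG₁) ⟩
  tail 0 ⊛ D₁ μ xS (G 0) (G 1)      ≈⟨ ⊛-comm (tail 0) (D₁ μ xS (G 0) (G 1)) ⟩
  D₁ μ xS (G 0) (G 1) ⊛ tail 0      ≈⟨ ⊘-spec (N₁ μ xS (G 0)) (D₁ μ xS (G 0) (G 1)) (≡1⇒≢0 (D₁-at-0 μ (G 0) (G 1) (G-at-0 0))) ⟩
  N₁ μ xS (G 0)                     ≈⟨ solve 2 (λ X g → P.N₁ (con (ℕtoℚ 0)) X g := con 1ℚ) ≈-refl xS (G 0) ⟩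
  1S                                ∎)
  where
  open ≈-Reasoning; open S-Solver
  μ = n̂ 0
  G₀≈1 : G 0 ≈ 1S
  G₀≈1 = begin
    G 0                          ≈⟨ solve 3 (λ g X h → g := g :* P.Δ (con (ℕtoℚ 0)) X h) ≈-refl (G 0) xS (G 1) ⟩
    G 0 ⊛ Δ μ xS (G 1)           ≈⟨ G-relation 0 ⟩
    1S                           ∎
  D≈1+xG₁ : D₁ μ xS (G 0) (G 1) ≈ 1S ⊕ xS ⊛ G 1
  D≈1+xG₁ = begin
    G 0 ⊛ (1S ⊕ lin 4 1 μ ⊛ (xS ⊛ G 1))   ≈⟨ ⊛-congˡ (1S ⊕ lin 4 1 μ ⊛ (xS ⊛ G 1)) G₀≈1 ⟩
    1S ⊛ (1S ⊕ lin 4 1 μ ⊛ (xS ⊛ G 1))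
      ≈⟨ solve 2 (λ X g → con 1ℚ :* (con 1ℚ :+ P.lin 4 1 (con (ℕtoℚ 0)) :* (X :* g)) := con 1ℚ :+ X :* g) ≈-refl xS (G 1) ⟩
    1S ⊕ xS ⊛ G 1                         ∎

convergent-agrees : ∀ r n → n ≤ r → convergent (suc r) n ≡ E n
convergent-agrees r n n≤r = begin
  mono 0ℚ 0 n + (1S ⊘ tailCF 1 r) n   ≡⟨ cong (_+ (1S ⊘ tailCF 1 r) n) (b₀≈0 n) ⟩
  0ℚ + (1S ⊘ tailCF 1 r) n            ≡⟨ +-identityˡ _ ⟩
  (1S ⊘ tailCF 1 r) n                 ≡⟨ ⊘-local r convergent≢0 (tail≢0 0) (λ _ _ → refl) (tail-agree r 0) n n≤r ⟩
  (1S ⊘ tail 0) n                     ≡⟨ sym (E-as-quotient n) ⟩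
  (1S ⊕ xS ⊛ G 1) n                   ≡⟨ sym (E-series n) ⟩
  E n                                 ∎
  where
  open ≡-Reasoning
  b₀≈0 : mono 0ℚ 0 ≈ 0S
  b₀≈0 zero = refl
  b₀≈0 (suc _) = refl
  convergent≢0 : tailCF 1 r 0 ≢ 0ℚ
  convergent≢0 = ≡1⇒≢0 (trans (tail-agree r 0 0 z≤n) (tail-at-0 0))

theorem1p1 : ∀ (N : ℕ) → ∃[ M ] (∀ (m : ℕ) → M ≤ m → ∀ (n : ℕ) → n ≤ N → convergent m n ≡ E n)
theorem1p1 N = suc N , agrees
  where
  agrees : ∀ m → suc N ≤ m → ∀ n → n ≤ N → convergent m n ≡ E n
  agrees (suc r) (s≤s N≤r) n n≤N = convergent-agrees r n (ℕP.≤-trans n≤N N≤r)
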